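{- Let $S$ be a finite totally ordered set, $R$ a commutative ring with $1$, $q\in R$, $A=R\langle t_s\mid s\in S\rangle$. Let $K,L\subseteq S$ with $k<l$ for all $k\in K$, $l\in L$. Then in $A$ $$t^-_Kt^-_L=\sum_{i=1}^{\#K}(-1)^{\#K-i}\,t^-_{L\cup K\setminus\{k_i\}}=\sum_{i=1}^{\#L}(-1)^{i-1}\,t^-_{K\cup L\setminus\{l_i\}}.$$
   Context: Subsets are enumerated increasingly: $K=\{k_1<\dots<k_{\#K}\}$, $L=\{l_1<\dots<l_{\#L}\}$. For $J=\{j_1<\dots<j_{\#J}\}$, $t_J=t_{j_1}\cdots t_{j_{\#J}}$; for $I=\{j_{\alpha_1}<\dots<j_{\alpha_{\#I}}\}\subseteq J$, $\ell_J(I)=\sum_\nu(\alpha_\nu-\nu)$; $t^-_J=\sum_{I\subseteq J,\ \#I\text{ odd}}(-1)^{\ell_J(I)}(-q)^{(\#I-1)/2}t_{J\setminus I}$. -}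

module Defs where

open import Level using (_⊔_)
open import Algebra.Bundles using (CommutativeRing)
open import Data.Bool using (Bool; true; false; if_then_else_)
open import Data.Nat as ℕ using (ℕ; zero; suc; _∸_; ⌊_/2⌋)
open import Data.Nat.ListAction using (sum)
open import Data.Fin using (Fin; _<?_)
open import Data.Fin.Subset using (Subset; ∣_∣)
open import Data.List as List using (List; []; _∷_; _++_; map; filter; length; concatMap; upTo; zip)
open import Data.Product using (_×_; _,_)
open import Data.Vec using ([]; _∷_)
open import Data.List.Properties using (≡-dec)
open import Data.Fin.Properties using (_≟_)
open import Relation.Nullary using (does)

isEven : ℕ → Bool
isEven zero = true
isEven (suc m) = Data.Bool.not (isEven m)

elems : ∀ {n} → Subset n → List (Fin n)
elems [] = []
elems (true  ∷ p) = Fin.zero ∷ map Fin.suc (elems p)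
elems (false ∷ p) = map Fin.suc (elems p)

subsetsOf : ∀ {n} → Subset n → List (Subset n)
subsetsOf [] = [] ∷ []
subsetsOf (true  ∷ J) = concatMap (λ I → (false ∷ I) ∷ (true ∷ I) ∷ []) (subsetsOf J)
subsetsOf (false ∷ J) = map (false ∷_) (subsetsOf J)

rank : ∀ {n} → Subset n → Fin n → ℕ
rank J x = suc (length (filter (λ j → j <? x) (elems J)))

-- ℓ_J(I) = Σ_ν (α_ν − ν)  where I = {j_{α₁} < … < j_{α_#I}} ⊆ J
-- (each summand is ≥ 0 since α_ν ≥ ν, so truncated subtraction is exact)
ellJ : ∀ {n} → Subset n → Subset n → ℕ
ellJ J I = sum (map (λ { (ν , i) → rank J i ∸ ν })
                         (zip (map suc (upTo ∣ I ∣)) (elems I)))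

-- An element is a finite formal R-linear combination of words in the
-- generators; two elements are equal iff all word coefficients agree
-- (free R-module on the monoid of words, with the concatenation product).

module FreeAlg {c ℓ} (R : CommutativeRing c ℓ) (n : ℕ) where
  open CommutativeRing R renaming (_+_ to _+R_; _*_ to _*R_; -_ to -R_; _≈_ to _≈R_)

  Word : Set
  Word = List (Fin n)

  A : Set c
  A = List (Carrier × Word)

  coeff : A → Word → Carrier
  coeff [] w = 0#
  coeff ((a , v) ∷ x) w = (if does (≡-dec _≟_ v w) then a else 0#) +R coeff x w

  _≈A_ : A → A → Set ℓ
  x ≈A y = ∀ w → coeff x w ≈R coeff y w

  0A : A
  0A = []

  _+A_ : A → A → A
  x +A y = x ++ y

  _·_ : Carrier → A → A
  r · x = map (λ { (a , v) → (r *R a , v) }) x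

  _*A_ : A → A → A
  x *A y = concatMap (λ { (a , v) → map (λ { (b , u) → (a *R b , v ++ u) }) y }) x

  ΣA : List A → A
  ΣA = List.foldr _+A_ 0A

  sgn : ℕ → Carrier
  sgn m = if isEven m then 1# else -R 1#

  pow : Carrier → ℕ → Carrier
  pow r zero = 1#
  pow r (suc m) = r *R pow r m

  t : Subset n → A
  t J = (1# , elems J) ∷ []

  tMinus : Carrier → Subset n → A
  tMinus q J =
    ΣA (map (λ I → if isEven ∣ I ∣ then 0A
                   else ((sgn (ellJ J I) *R pow (-R q) ⌊ ∣ I ∣ ∸ 1 /2⌋) · t (J Data.Fin.Subset.─ I)))
            (subsetsOf J))

  rhsK : Carrier → Subset n → Subset n → A
  rhsK q K L = ΣA (map (λ { (i , k) → sgn (∣ K ∣ ∸ i) · tMinus q ((L Data.Fin.Subset.∪ K) Data.Fin.Subset.- k) })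
                       (zip (map suc (upTo ∣ K ∣)) (elems K)))

  rhsL : Carrier → Subset n → Subset n → A
  rhsL q K L = ΣA (map (λ { (i , l) → sgn (i ∸ 1) · tMinus q ((K Data.Fin.Subset.∪ L) Data.Fin.Subset.- l) })
                       (zip (map suc (upTo ∣ L ∣)) (elems L)))

module Submission where

-- For a word w define t⁺_w, t⁻_w by splitting off the first letter a:
--   t⁺_∅ = 1,  t⁻_∅ = 0,  t⁺_{aw} = t_a t⁺_w − q t⁻_w,  t⁻_{aw} = t⁺_w − t_a t⁻_w.
-- (1) Bridge: the paper's t⁻_J (a sum over odd I ⊆ J weighted by ℓ_J(I)) is t⁻ of the
--     enumeration of J; proved together with its even analogue by induction on the ambient set.
-- (2) Product formula: t^±_{uv} is the even/odd part of the super-commutative product of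
--     t^±_u and t^±_v, the odd part of u carrying the sign (-1)^|u|.
-- (3) The alternating deletion sum ∂w = Σᵢ (-1)^{i-1} (w without wᵢ) acts as a derivation with
--     ∂t⁺ = t⁻ and ∂t⁻ = 0; with (2) this gives Σᵢ (-1)^{i-1} t⁻_{u (v∖vᵢ)} = t⁻_u t⁻_v and
--     Σᵢ (-1)^{|u|-i} t⁻_{(u∖uᵢ) v} = t⁻_u t⁻_v.
-- (4) For K < L the enumeration of K ∪ L is uv, so both sums of the lemma have this form.

open import Defs
open import Algebra.Bundles using (CommutativeRing; CommutativeMonoid)
open import Data.Bool using (true; false; if_then_else_)
open import Data.Empty using (⊥-elim)
open import Data.Fin as F using (Fin; _<_; _<?_)
import Data.Fin.Properties as FP
open import Data.Fin.Subset using (Subset; ∣_∣; _─_; _∪_; _-_; _∈_; ⊥)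
import Data.Fin.Subset.Properties as SP
open import Data.List using (List; []; _∷_; _++_; map; concat; concatMap; filter; length; upTo; zip)
import Data.List.Properties as LP
open import Data.List.Relation.Unary.All as All using (All; []; _∷_)
import Data.List.Relation.Unary.All.Properties as AllP
open import Data.List.Relation.Unary.AllPairs using (AllPairs; []; _∷_)
open import Data.Nat as ℕ using (ℕ; zero; suc; _+_; _∸_; _≤_; z≤n; s≤s; ⌊_/2⌋)
import Data.Nat.Properties as NP
open import Data.Nat.ListAction using (sum)
open import Data.Product as Product using (_×_; _,_; proj₁; proj₂; Σ)
open import Data.Sum using (_⊎_; inj₁; inj₂)
open import Data.Vec using ([]; _∷_; here; there)
open import Function using (id)
open import Level using (_⊔_)
open import Relation.Binary.Bundles using (Setoid)
open import Relation.Nullary using (¬_; Dec; yes; no; does)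
open import Relation.Nullary.Decidable using (¬?)
open import Relation.Binary.PropositionalEquality as P using (_≡_; _≢_)

zip-map-left : ∀ {A B C : Set} (f : A → C) (xs : List A) (ys : List B) →
               zip (map f xs) ys ≡ map (Product.map f id) (zip xs ys)
zip-map-left f xs ys = P.trans (P.cong (zip (map f xs)) (P.sym (LP.map-id ys))) (LP.zip-map f id xs ys)

zip-map-right : ∀ {A B C : Set} (g : B → C) (xs : List A) (ys : List B) →
                zip xs (map g ys) ≡ map (Product.map id g) (zip xs ys)
zip-map-right g xs ys = P.trans (P.cong (λ xs' → zip xs' (map g ys)) (P.sym (LP.map-id xs))) (LP.zip-map id g xs ys)

All-zip : ∀ {A B : Set} {Q : B → Set} (xs : List A) {ys : List B} → All Q ys → All (λ p → Q (proj₂ p)) (zip xs ys)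
All-zip [] _ = []
All-zip (x ∷ xs) [] = []
All-zip (x ∷ xs) (q ∷ qs) = q ∷ All-zip xs qs

concat-map-family : ∀ {a b x} {A : Set a} {B : Set b} {X : Set x} (h : A → B) (F : X → List A) xs →
                    concat (map (λ x → map h (F x)) xs) ≡ map h (concat (map F xs))
concat-map-family h F xs = P.trans (P.cong concat (LP.map-∘ xs)) (LP.concat-map (map F xs))

without : ∀ {n} → Fin n → List (Fin n) → List (Fin n)
without x = filter (λ y → ¬? (y FP.≟ x))

without-absent : ∀ {n} (x : Fin n) {w} → All (_≢ x) w → without x w ≡ w
without-absent x = LP.filter-all (λ y → ¬? (y FP.≟ x))

without-++ : ∀ {n} (x : Fin n) u v → without x (u ++ v) ≡ without x u ++ without x v
without-++ x = LP.filter-++ (λ y → ¬? (y FP.≟ x))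

without-head : ∀ {n} (a : Fin n) w → without a (a ∷ w) ≡ without a w
without-head a w = LP.filter-reject (λ y → ¬? (y FP.≟ a)) (λ a≢a → a≢a P.refl)

without-other : ∀ {n} {a x : Fin n} w → a ≢ x → without x (a ∷ w) ≡ a ∷ without x w
without-other {x = x} w = LP.filter-accept (λ y → ¬? (y FP.≟ x))

without-suc : ∀ {n} (x : Fin n) w → without (F.suc x) (map F.suc w) ≡ map F.suc (without x w)
without-suc x [] = P.refl
without-suc x (y ∷ w) with y FP.≟ x
... | yes _ = without-suc x w
... | no _ = P.cong (F.suc y ∷_) (without-suc x w)

without-zero : ∀ {n} (w : List (Fin n)) → without F.zero (map F.suc w) ≡ map F.suc w
without-zero w = without-absent F.zero (AllP.map⁺ (All.universal (λ _ ()) w))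

elems-remove : ∀ {n} (J : Subset n) x → elems (J - x) ≡ without x (elems J)
elems-remove (false ∷ J) F.zero =
  P.trans (P.cong (λ K → map F.suc (elems K)) (SP.p─⊥≡p J)) (P.sym (without-zero (elems J)))
elems-remove (true ∷ J) F.zero =
  P.trans (P.cong (λ K → map F.suc (elems K)) (SP.p─⊥≡p J)) (P.sym (without-zero (elems J)))
elems-remove (false ∷ J) (F.suc x) =
  P.trans (P.cong (map F.suc) (elems-remove J x)) (P.sym (without-suc x (elems J)))
elems-remove (true ∷ J) (F.suc x) =
  P.cong (F.zero ∷_) (P.trans (P.cong (map F.suc) (elems-remove J x)) (P.sym (without-suc x (elems J))))

elems-⊥ : ∀ {n} → elems (⊥ {n}) ≡ []
elems-⊥ {zero} = P.refl
elems-⊥ {suc n} = P.cong (map F.suc) elems-⊥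

Separated : ∀ {n} → Subset n → Subset n → Set
Separated K L = ∀ k l → k ∈ K → l ∈ L → k < l

separated-tail : ∀ {n} {a b} {K L : Subset n} → Separated (a ∷ K) (b ∷ L) → Separated K L
separated-tail sep k l k∈K l∈L = NP.≤-pred (sep (F.suc k) (F.suc l) (there k∈K) (there l∈L))

elems-∪ : ∀ {n} (K L : Subset n) → Separated K L → elems (K ∪ L) ≡ elems K ++ elems L
elems-∪ [] [] sep = P.refl
elems-∪ (true ∷ K) (true ∷ L) sep = ⊥-elim (NP.n≮n 0 (sep F.zero F.zero here here))
elems-∪ (true ∷ K) (false ∷ L) sep =
  P.cong (F.zero ∷_) (P.trans (P.cong (map F.suc) (elems-∪ K L (separated-tail sep))) (LP.map-++ F.suc (elems K) (elems L)))
elems-∪ (false ∷ K) (false ∷ L) sep =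
  P.trans (P.cong (map F.suc) (elems-∪ K L (separated-tail sep))) (LP.map-++ F.suc (elems K) (elems L))
elems-∪ {suc n} (false ∷ K) (true ∷ L) sep
  rewrite SP.Empty-unique {p = K} (λ { (k , k∈K) → NP.n≮0 (sep (F.suc k) F.zero (there k∈K) here) })
        | SP.∪-identityˡ L | elems-⊥ {n} = P.refl

elems-∈ : ∀ {n} (J : Subset n) → All (_∈ J) (elems J)
elems-∈ [] = []
elems-∈ (true ∷ J) = here ∷ AllP.map⁺ (All.map there (elems-∈ J))
elems-∈ (false ∷ J) = AllP.map⁺ (All.map there (elems-∈ J))

Distinct : ∀ {n} → List (Fin n) → Set
Distinct = AllPairs _≢_

distinct-suc : ∀ {n} {w : List (Fin n)} → Distinct w → Distinct (map F.suc w)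
distinct-suc [] = []
distinct-suc (x∉w ∷ d) = AllP.map⁺ (All.map (λ x≢y eq → x≢y (FP.suc-injective eq)) x∉w) ∷ distinct-suc d

elems-distinct : ∀ {n} (J : Subset n) → Distinct (elems J)
elems-distinct [] = []
elems-distinct (true ∷ J) = AllP.map⁺ (All.universal (λ _ ()) (elems J)) ∷ distinct-suc (elems-distinct J)
elems-distinct (false ∷ J) = distinct-suc (elems-distinct J)

length-elems : ∀ {n} (J : Subset n) → length (elems J) ≡ ∣ J ∣
length-elems [] = P.refl
length-elems (true ∷ J) = P.cong suc (P.trans (LP.length-map F.suc (elems J)) (length-elems J))
length-elems (false ∷ J) = P.trans (LP.length-map F.suc (elems J)) (length-elems J)

positions : ℕ → List ℕ
positions m = map suc (upTo m)

positions-suc : ∀ m → positions (suc m) ≡ 1 ∷ map suc (positions m)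
positions-suc m = P.cong (λ ps → 1 ∷ map suc ps) (P.sym (LP.map-applyUpTo (λ i → i) suc m))

pairs : ∀ {n} → Subset n → List (ℕ × Fin n)
pairs I = zip (positions ∣ I ∣) (elems I)

pairs-outside : ∀ {n} (I : Subset n) → pairs (false ∷ I) ≡ map (Product.map id F.suc) (pairs I)
pairs-outside I = zip-map-right F.suc (positions ∣ I ∣) (elems I)

pairs-inside : ∀ {n} (I : Subset n) → pairs (true ∷ I) ≡ (1 , F.zero) ∷ map (Product.map suc F.suc) (pairs I)
pairs-inside I =
  P.trans (P.cong (λ ps → zip ps (F.zero ∷ map F.suc (elems I))) (positions-suc ∣ I ∣))
        (P.cong ((1 , F.zero) ∷_) (LP.zip-map suc F.suc (positions ∣ I ∣) (elems I)))

length-pairs : ∀ {n} (I : Subset n) → length (pairs I) ≡ ∣ I ∣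
length-pairs I = P.trans (LP.length-zipWith _,_ (positions ∣ I ∣) (elems I))
  (P.trans (P.cong₂ ℕ._⊓_ (P.trans (LP.length-map suc (upTo ∣ I ∣)) (LP.length-upTo ∣ I ∣)) (length-elems I)) (NP.⊓-idem ∣ I ∣))

filter-below-suc : ∀ {n} (i : Fin n) (xs : List (Fin n)) →
                   length (filter (_<? F.suc i) (map F.suc xs)) ≡ length (filter (_<? i) xs)
filter-below-suc i [] = P.refl
filter-below-suc i (x ∷ xs) with does (x <? i)
... | true = P.cong suc (filter-below-suc i xs)
... | false = filter-below-suc i xs

filter-below-zero : ∀ {n} (xs : List (Fin n)) → length (filter (_<? F.zero {n}) (map F.suc xs)) ≡ 0
filter-below-zero [] = P.refl
filter-below-zero (x ∷ xs) = filter-below-zero xs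

rank-outside : ∀ {n} (J : Subset n) i → rank (false ∷ J) (F.suc i) ≡ rank J i
rank-outside J i = P.cong suc (filter-below-suc i (elems J))

rank-inside : ∀ {n} (J : Subset n) i → rank (true ∷ J) (F.suc i) ≡ suc (rank J i)
rank-inside J i = P.cong (λ m → suc (suc m)) (filter-below-suc i (elems J))

rank-zero : ∀ {n} (J : Subset n) → rank (true ∷ J) F.zero ≡ 1
rank-zero J = P.cong suc (filter-below-zero (elems J))

ell-outside : ∀ {n} (J I : Subset n) → ellJ (false ∷ J) (false ∷ I) ≡ ellJ J I
ell-outside J I = P.cong sum (P.trans (P.cong (map _) (pairs-outside I)) (P.trans (P.sym (LP.map-∘ (pairs I)))
  (LP.map-cong (λ p → P.cong (_∸ proj₁ p) (rank-outside J (proj₂ p))) (pairs I))))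

ell-inside : ∀ {n} (J I : Subset n) → ellJ (true ∷ J) (true ∷ I) ≡ ellJ J I
ell-inside J I = P.trans (P.cong sum (P.cong (map _) (pairs-inside I)))
  (P.cong₂ _+_ (P.cong (_∸ 1) (rank-zero J)) (P.cong sum (P.trans (P.sym (LP.map-∘ (pairs I)))
    (LP.map-cong (λ p → P.cong (_∸ suc (proj₁ p)) (rank-inside J (proj₂ p))) (pairs I)))))

-- The ν-th element of I has rank ≥ ν in J; this holds for I ⊆ J and makes
-- the truncated subtractions in ℓ_J(I) exact.
RankBounded : ∀ {n} → Subset n → Subset n → Set
RankBounded J I = All (λ p → proj₁ p ≤ rank J (proj₂ p)) (pairs I)

subsets-rankBounded : ∀ {n} (J : Subset n) → All (RankBounded J) (subsetsOf J)
subsets-rankBounded [] = [] ∷ []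
subsets-rankBounded (false ∷ J) = AllP.map⁺ (All.map (λ {I} → outside {I}) (subsets-rankBounded J))
  where
  outside : ∀ {I} → RankBounded J I → RankBounded (false ∷ J) (false ∷ I)
  outside {I} b = P.subst (All _) (P.sym (pairs-outside I))
    (AllP.map⁺ (All.map (λ {p} le → P.subst (proj₁ p ≤_) (P.sym (rank-outside J (proj₂ p))) le) b))
subsets-rankBounded (true ∷ J) =
  AllP.concat⁺ (AllP.map⁺ (All.map (λ {I} b → skip {I} b ∷ keep {I} b ∷ []) (subsets-rankBounded J)))
  where
  skip : ∀ {I} → RankBounded J I → RankBounded (true ∷ J) (false ∷ I)
  skip {I} b = P.subst (All _) (P.sym (pairs-outside I))
    (AllP.map⁺ (All.map (λ {p} le → P.subst (proj₁ p ≤_) (P.sym (rank-inside J (proj₂ p))) (NP.m≤n⇒m≤1+n le)) b))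
  keep : ∀ {I} → RankBounded J I → RankBounded (true ∷ J) (true ∷ I)
  keep {I} b = P.subst (All _) (P.sym (pairs-inside I))
    (P.subst (1 ≤_) (P.sym (rank-zero J)) (s≤s z≤n)
      ∷ AllP.map⁺ (All.map (λ {p} le → P.subst (suc (proj₁ p) ≤_) (P.sym (rank-inside J (proj₂ p))) (s≤s le)) b))

sum-map-suc : ∀ {A : Set} (g : A → ℕ) (xs : List A) → sum (map (λ x → suc (g x)) xs) ≡ length xs + sum (map g xs)
sum-map-suc g [] = P.refl
sum-map-suc g (x ∷ xs) = P.cong suc (P.trans (P.cong (g x +_) (sum-map-suc g xs)) (x∙yz≈y∙xz (g x) (length xs) _))
  where open import Algebra.Properties.CommutativeSemigroup NP.+-commutativeSemigroup using (x∙yz≈y∙xz)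

-- Skipping a new least element of J moves every element of I one place later in J.
ell-skip : ∀ {n} (J I : Subset n) → RankBounded J I → ellJ (true ∷ J) (false ∷ I) ≡ ∣ I ∣ + ellJ J I
ell-skip J I bounded = begin
  sum (map _ (pairs (false ∷ I)))
    ≡⟨ P.cong sum (P.trans (P.cong (map _) (pairs-outside I)) (P.sym (LP.map-∘ (pairs I)))) ⟩
  sum (map (λ p → rank (true ∷ J) (F.suc (proj₂ p)) ∸ proj₁ p) (pairs I))
    ≡⟨ P.cong sum (LP.map-cong-local (All.map (λ {p} le →
         P.trans (P.cong (_∸ proj₁ p) (rank-inside J (proj₂ p))) (NP.+-∸-assoc 1 le)) bounded)) ⟩
  sum (map (λ p → suc (rank J (proj₂ p) ∸ proj₁ p)) (pairs I))
    ≡⟨ sum-map-suc _ (pairs I) ⟩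
  length (pairs I) + ellJ J I
    ≡⟨ P.cong (_+ ellJ J I) (length-pairs I) ⟩
  ∣ I ∣ + ellJ J I ∎
  where open P.≡-Reasoning

module FreeAlgebraLaws {c ℓ} (R : CommutativeRing c ℓ) (n : ℕ) where
  open CommutativeRing R renaming (_+_ to _+R_; _*_ to _*R_; -_ to -R_; _≈_ to _≈R_)
  open FreeAlg R n
  open import Relation.Binary.Reasoning.Setoid setoid
  open import Algebra.Properties.Ring ring using (-1*x≈-x; -‿involutive; -‿distribˡ-*; -‿distribʳ-*)

  mono : Word → Word → Carrier → Carrier
  mono v w a = if does (LP.≡-dec FP._≟_ v w) then a else 0#

  mono-≡ : ∀ v w a → v ≡ w → mono v w a ≡ a
  mono-≡ v w a eq with LP.≡-dec FP._≟_ v w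
  ... | yes _ = P.refl
  ... | no v≢w = ⊥-elim (v≢w eq)

  mono-≢ : ∀ v w a → ¬ v ≡ w → mono v w a ≡ 0#
  mono-≢ v w a v≢w with LP.≡-dec FP._≟_ v w
  ... | yes eq = ⊥-elim (v≢w eq)
  ... | no _ = P.refl

  mono-cong : ∀ v w {a b} → a ≈R b → mono v w a ≈R mono v w b
  mono-cong v w a≈b with LP.≡-dec FP._≟_ v w
  ... | yes _ = a≈b
  ... | no _ = refl

  mono-*ˡ : ∀ v w r a → r *R mono v w a ≈R mono v w (r *R a)
  mono-*ˡ v w r a with LP.≡-dec FP._≟_ v w
  ... | yes _ = refl
  ... | no _ = zeroʳ r

  mono-∷ : ∀ x v w a → mono (x ∷ v) (x ∷ w) a ≡ mono v w a
  mono-∷ x v w a = by-cases (LP.≡-dec FP._≟_ v w)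
    where
    by-cases : Dec (v ≡ w) → mono (x ∷ v) (x ∷ w) a ≡ mono v w a
    by-cases (yes eq) = P.trans (mono-≡ (x ∷ v) (x ∷ w) a (P.cong (x ∷_) eq)) (P.sym (mono-≡ v w a eq))
    by-cases (no v≢w) = P.trans (mono-≢ (x ∷ v) (x ∷ w) a (λ eq → v≢w (LP.∷-injectiveʳ eq))) (P.sym (mono-≢ v w a v≢w))

  Σ[_]_ : ∀ {a} {X : Set a} → List X → (X → Carrier) → Carrier
  Σ[ [] ] f = 0#
  Σ[ x ∷ xs ] f = f x +R Σ[ xs ] f

  Σ-cong : ∀ {a} {X : Set a} (xs : List X) {f g : X → Carrier} → (∀ x → f x ≈R g x) → Σ[ xs ] f ≈R Σ[ xs ] g
  Σ-cong [] f≈g = refl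
  Σ-cong (x ∷ xs) f≈g = +-cong (f≈g x) (Σ-cong xs f≈g)

  Σ-zero : ∀ {a} {X : Set a} (xs : List X) {f : X → Carrier} → (∀ x → f x ≈R 0#) → Σ[ xs ] f ≈R 0#
  Σ-zero [] f≈0 = refl
  Σ-zero (x ∷ xs) f≈0 = trans (+-cong (f≈0 x) (Σ-zero xs f≈0)) (+-identityˡ 0#)

  Σ-+ : ∀ {a} {X : Set a} (xs : List X) (f g : X → Carrier) → Σ[ xs ] (λ x → f x +R g x) ≈R Σ[ xs ] f +R Σ[ xs ] g
  Σ-+ [] f g = sym (+-identityˡ 0#)
  Σ-+ (x ∷ xs) f g = begin
    (f x +R g x) +R Σ[ xs ] (λ y → f y +R g y) ≈⟨ +-congˡ (Σ-+ xs f g) ⟩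
    (f x +R g x) +R (Σ[ xs ] f +R Σ[ xs ] g)   ≈⟨ +-assoc (f x) (g x) _ ⟩
    f x +R (g x +R (Σ[ xs ] f +R Σ[ xs ] g))   ≈⟨ +-congˡ (sym (+-assoc (g x) _ _)) ⟩
    f x +R ((g x +R Σ[ xs ] f) +R Σ[ xs ] g)   ≈⟨ +-congˡ (+-congʳ (+-comm (g x) _)) ⟩
    f x +R ((Σ[ xs ] f +R g x) +R Σ[ xs ] g)   ≈⟨ +-congˡ (+-assoc _ (g x) _) ⟩
    f x +R (Σ[ xs ] f +R (g x +R Σ[ xs ] g))   ≈⟨ sym (+-assoc (f x) _ _) ⟩
    (f x +R Σ[ xs ] f) +R (g x +R Σ[ xs ] g)   ∎

  Σ-*ˡ : ∀ {a} {X : Set a} (xs : List X) r (f : X → Carrier) → r *R Σ[ xs ] f ≈R Σ[ xs ] (λ x → r *R f x)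
  Σ-*ˡ [] r f = zeroʳ r
  Σ-*ˡ (x ∷ xs) r f = trans (distribˡ r _ _) (+-congˡ (Σ-*ˡ xs r f))

  Σ-*ʳ : ∀ {a} {X : Set a} (xs : List X) r (f : X → Carrier) → Σ[ xs ] f *R r ≈R Σ[ xs ] (λ x → f x *R r)
  Σ-*ʳ [] r f = zeroˡ r
  Σ-*ʳ (x ∷ xs) r f = trans (distribʳ r _ _) (+-congˡ (Σ-*ʳ xs r f))

  Σ-swap : ∀ {a b} {X : Set a} {Y : Set b} (xs : List X) (ys : List Y) (f : X → Y → Carrier) →
           Σ[ xs ] (λ x → Σ[ ys ] (f x)) ≈R Σ[ ys ] (λ y → Σ[ xs ] (λ x → f x y))
  Σ-swap [] ys f = sym (Σ-zero ys (λ _ → refl))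
  Σ-swap (x ∷ xs) ys f = trans (+-congˡ (Σ-swap xs ys f)) (sym (Σ-+ ys (f x) _))

  Σ-map : ∀ {a b} {X : Set a} {Y : Set b} (g : X → Y) (xs : List X) f → Σ[ map g xs ] f ≡ Σ[ xs ] (λ x → f (g x))
  Σ-map g [] f = P.refl
  Σ-map g (x ∷ xs) f = P.cong (f (g x) +R_) (Σ-map g xs f)

  coeff-Σ : ∀ x w → coeff x w ≡ Σ[ x ] (λ p → mono (proj₂ p) w (proj₁ p))
  coeff-Σ [] w = P.refl
  coeff-Σ ((a , v) ∷ x) w = P.cong (mono v w a +R_) (coeff-Σ x w)

  coeff-+A : ∀ x y w → coeff (x +A y) w ≈R coeff x w +R coeff y w
  coeff-+A [] y w = sym (+-identityˡ _)
  coeff-+A ((a , v) ∷ x) y w = trans (+-congˡ (coeff-+A x y w)) (sym (+-assoc _ _ _))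

  coeff-map : ∀ (f : Carrier × Word → Carrier × Word) x w →
              coeff (map f x) w ≡ Σ[ x ] (λ p → mono (proj₂ (f p)) w (proj₁ (f p)))
  coeff-map f [] w = P.refl
  coeff-map f (p ∷ x) w = P.cong (_ +R_) (coeff-map f x w)

  coeff-· : ∀ r x w → coeff (r · x) w ≈R r *R coeff x w
  coeff-· r [] w = sym (zeroʳ r)
  coeff-· r ((a , v) ∷ x) w = trans (+-cong (sym (mono-*ˡ v w r a)) (coeff-· r x w)) (sym (distribˡ r _ _))

  -- Equality in A packaged as a record, so that both sides can be inferred from a proof.
  record _≋_ (x y : A) : Set ℓ where
    constructor mk
    field get : x ≈A y
  open _≋_ public
  infix 4 _≋_

  ≋-refl : ∀ {x} → x ≋ x
  ≋-refl = mk (λ _ → refl)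

  ≋-sym : ∀ {x y} → x ≋ y → y ≋ x
  ≋-sym (mk p) = mk (λ w → sym (p w))

  ≋-trans : ∀ {x y z} → x ≋ y → y ≋ z → x ≋ z
  ≋-trans (mk p) (mk q) = mk (λ w → trans (p w) (q w))

  ≋-setoid : Setoid c ℓ
  ≋-setoid = record { Carrier = A ; _≈_ = _≋_ ; isEquivalence = record { refl = ≋-refl ; sym = ≋-sym ; trans = ≋-trans } }

  ≡⇒≋ : ∀ {x y} → x ≡ y → x ≋ y
  ≡⇒≋ P.refl = ≋-refl

  +A-cong : ∀ {x x' y y'} → x ≋ x' → y ≋ y' → (x +A y) ≋ (x' +A y')
  +A-cong {x} {x'} {y} {y'} (mk p) (mk q) =
    mk (λ w → trans (coeff-+A x y w) (trans (+-cong (p w) (q w)) (sym (coeff-+A x' y' w))))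

  +A-congˡ : ∀ x {y y'} → y ≋ y' → (x +A y) ≋ (x +A y')
  +A-congˡ x = +A-cong (≋-refl {x})

  +A-comm : ∀ x y → (x +A y) ≋ (y +A x)
  +A-comm x y = mk (λ w → trans (coeff-+A x y w) (trans (+-comm _ _) (sym (coeff-+A y x w))))

  +A-identityʳ : ∀ x → (x +A 0A) ≋ x
  +A-identityʳ x = ≡⇒≋ (LP.++-identityʳ x)

  +A-commutativeMonoid : CommutativeMonoid c ℓ
  +A-commutativeMonoid = record
    { Carrier = A ; _≈_ = _≋_ ; _∙_ = _+A_ ; ε = 0A
    ; isCommutativeMonoid = record
      { isMonoid = record
        { isSemigroup = record
          { isMagma = record { isEquivalence = Setoid.isEquivalence ≋-setoid ; ∙-cong = +A-cong }
          ; assoc = λ x y z → ≡⇒≋ (LP.++-assoc x y z) }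
        ; identity = (λ x → ≋-refl) , +A-identityʳ }
      ; comm = +A-comm } }

  +A-interchange : ∀ a b c d → ((a +A b) +A (c +A d)) ≋ ((a +A c) +A (b +A d))
  +A-interchange = solve 4 (λ a b c d → (a ⊕ b) ⊕ (c ⊕ d) ⊜ (a ⊕ c) ⊕ (b ⊕ d)) ≋-refl
    where open import Algebra.Solver.CommutativeMonoid +A-commutativeMonoid using (solve; _⊕_; _⊜_)

  ·-congʳ : ∀ r {x y} → x ≋ y → (r · x) ≋ (r · y)
  ·-congʳ r {x} {y} (mk p) = mk (λ w → trans (coeff-· r x w) (trans (*-congˡ (p w)) (sym (coeff-· r y w))))

  ·-+A : ∀ r x y → (r · (x +A y)) ≡ ((r · x) +A (r · y))
  ·-+A r x y = LP.map-++ _ x y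

  ·-· : ∀ r s {t} x → r *R s ≈R t → (r · (s · x)) ≋ (t · x)
  ·-· r s {t} x rs≈t = mk (λ w → begin
    coeff (r · (s · x)) w   ≈⟨ coeff-· r (s · x) w ⟩
    r *R coeff (s · x) w    ≈⟨ *-congˡ (coeff-· s x w) ⟩
    r *R (s *R coeff x w)   ≈⟨ sym (*-assoc r s _) ⟩
    (r *R s) *R coeff x w   ≈⟨ *-congʳ rs≈t ⟩
    t *R coeff x w          ≈⟨ sym (coeff-· t x w) ⟩
    coeff (t · x) w         ∎)

  ·-comm : ∀ r s x → (r · (s · x)) ≋ (s · (r · x))
  ·-comm r s x = ≋-trans (·-· r s x (*-comm r s)) (≋-sym (·-· s r x refl))

  ·-identity : ∀ x → (1# · x) ≋ x
  ·-identity x = mk (λ w → trans (coeff-· 1# x w) (*-identityˡ _))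

  ·-inverse : ∀ x → (x +A ((-R 1#) · x)) ≋ 0A
  ·-inverse x = mk (λ w → trans (coeff-+A x _ w) (trans (+-congˡ (trans (coeff-· _ x w) (-1*x≈-x _))) (-‿inverseʳ _)))

  splits : Word → List (Word × Word)
  splits [] = ([] , []) ∷ []
  splits (y ∷ w) = ([] , y ∷ w) ∷ map (λ s → (y ∷ proj₁ s , proj₂ s)) (splits w)

  mono-split : ∀ w v u a b →
               Σ[ splits w ] (λ s → mono v (proj₁ s) a *R mono u (proj₂ s) b) ≈R mono (v ++ u) w (a *R b)
  mono-split [] [] u a b = trans (+-identityʳ _) (mono-*ˡ u [] a b)
  mono-split [] (x ∷ v) u a b = trans (+-identityʳ _) (zeroˡ _)
  mono-split (y ∷ w) v u a b = trans (+-congˡ (reflexive (Σ-map _ (splits w) _))) (cons-step v)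
    where
    -- every nonempty prefix of y ∷ w starts with y
    cons-step : ∀ v → mono v [] a *R mono u (y ∷ w) b
                      +R Σ[ splits w ] (λ s → mono v (y ∷ proj₁ s) a *R mono u (proj₂ s) b)
                      ≈R mono (v ++ u) (y ∷ w) (a *R b)
    cons-step [] = trans (+-cong (mono-*ˡ u (y ∷ w) a b) (Σ-zero (splits w) (λ s → zeroˡ _))) (+-identityʳ _)
    cons-step (x ∷ v) = first-letter v (x FP.≟ y)
      where
      first-letter : ∀ {x} v → Dec (x ≡ y) →
                     0# *R mono u (y ∷ w) b
                     +R Σ[ splits w ] (λ s → mono (x ∷ v) (y ∷ proj₁ s) a *R mono u (proj₂ s) b)
                     ≈R mono (x ∷ v ++ u) (y ∷ w) (a *R b)
      first-letter {x} v (yes P.refl) = begin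
        0# *R mono u (x ∷ w) b +R Σ[ splits w ] (λ s → mono (x ∷ v) (x ∷ proj₁ s) a *R mono u (proj₂ s) b)
          ≈⟨ trans (+-congʳ (zeroˡ _)) (+-identityˡ _) ⟩
        Σ[ splits w ] (λ s → mono (x ∷ v) (x ∷ proj₁ s) a *R mono u (proj₂ s) b)
          ≈⟨ Σ-cong (splits w) (λ s → *-congʳ (reflexive (mono-∷ x v (proj₁ s) a))) ⟩
        Σ[ splits w ] (λ s → mono v (proj₁ s) a *R mono u (proj₂ s) b)
          ≈⟨ mono-split w v u a b ⟩
        mono (v ++ u) w (a *R b)
          ≡⟨ P.sym (mono-∷ x (v ++ u) w (a *R b)) ⟩
        mono (x ∷ v ++ u) (x ∷ w) (a *R b) ∎
      first-letter {x} v (no x≢y) = begin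
        0# *R mono u (y ∷ w) b +R Σ[ splits w ] (λ s → mono (x ∷ v) (y ∷ proj₁ s) a *R mono u (proj₂ s) b)
          ≈⟨ +-cong (zeroˡ _) (Σ-zero (splits w) (λ s → trans (*-congʳ (reflexive (mono-≢ _ _ a (differs {v} (proj₁ s))))) (zeroˡ _))) ⟩
        0# +R 0#
          ≈⟨ +-identityʳ 0# ⟩
        0#
          ≡⟨ P.sym (mono-≢ _ _ (a *R b) (differs {v ++ u} w)) ⟩
        mono (x ∷ v ++ u) (y ∷ w) (a *R b) ∎
        where
        differs : ∀ {v'} w' → ¬ (x ∷ v') ≡ (y ∷ w')
        differs w' eq = x≢y (LP.∷-injectiveˡ eq)

  coeff-concatMap : ∀ (g : Carrier × Word → A) x w → coeff (concatMap g x) w ≈R Σ[ x ] (λ p → coeff (g p) w)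
  coeff-concatMap g [] w = refl
  coeff-concatMap g (p ∷ x) w = trans (coeff-+A (g p) (concatMap g x) w) (+-congˡ (coeff-concatMap g x w))

  coeff-*A : ∀ x y w → coeff (x *A y) w ≈R Σ[ splits w ] (λ s → coeff x (proj₁ s) *R coeff y (proj₂ s))
  coeff-*A x y w = begin
    coeff (x *A y) w
      ≈⟨ coeff-concatMap _ x w ⟩
    Σ[ x ] (λ p → coeff (map (λ p' → (proj₁ p *R proj₁ p' , proj₂ p ++ proj₂ p')) y) w)
      ≈⟨ Σ-cong x (λ p → reflexive (coeff-map _ y w)) ⟩
    Σ[ x ] (λ p → Σ[ y ] (λ p' → mono (proj₂ p ++ proj₂ p') w (proj₁ p *R proj₁ p')))
      ≈⟨ Σ-cong x (λ p → Σ-cong y (λ p' → sym (mono-split w (proj₂ p) (proj₂ p') (proj₁ p) (proj₁ p')))) ⟩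
    Σ[ x ] (λ p → Σ[ y ] (λ p' → Σ[ splits w ] (λ s → m p (proj₁ s) *R m p' (proj₂ s))))
      ≈⟨ Σ-cong x (λ p → Σ-swap y (splits w) _) ⟩
    Σ[ x ] (λ p → Σ[ splits w ] (λ s → Σ[ y ] (λ p' → m p (proj₁ s) *R m p' (proj₂ s))))
      ≈⟨ Σ-swap x (splits w) _ ⟩
    Σ[ splits w ] (λ s → Σ[ x ] (λ p → Σ[ y ] (λ p' → m p (proj₁ s) *R m p' (proj₂ s))))
      ≈⟨ Σ-cong (splits w) (λ s → Σ-cong x (λ p → sym (Σ-*ˡ y _ _))) ⟩
    Σ[ splits w ] (λ s → Σ[ x ] (λ p → m p (proj₁ s) *R Σ[ y ] (λ p' → m p' (proj₂ s))))
      ≈⟨ Σ-cong (splits w) (λ s → sym (Σ-*ʳ x _ _)) ⟩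
    Σ[ splits w ] (λ s → Σ[ x ] (λ p → m p (proj₁ s)) *R Σ[ y ] (λ p' → m p' (proj₂ s)))
      ≈⟨ Σ-cong (splits w) (λ s → reflexive (P.sym (P.cong₂ _*R_ (coeff-Σ x (proj₁ s)) (coeff-Σ y (proj₂ s))))) ⟩
    Σ[ splits w ] (λ s → coeff x (proj₁ s) *R coeff y (proj₂ s)) ∎
    where
    m : Carrier × Word → Word → Carrier
    m p v = mono (proj₂ p) v (proj₁ p)

  *A-cong : ∀ {x x' y y'} → x ≋ x' → y ≋ y' → (x *A y) ≋ (x' *A y')
  *A-cong {x} {x'} {y} {y'} (mk p) (mk q) = mk (λ w → trans (coeff-*A x y w)
    (trans (Σ-cong (splits w) (λ s → *-cong (p (proj₁ s)) (q (proj₂ s)))) (sym (coeff-*A x' y' w))))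

  *A-distribˡ : ∀ x y z → (x *A (y +A z)) ≋ ((x *A y) +A (x *A z))
  *A-distribˡ x y z = mk (λ w → begin
    coeff (x *A (y +A z)) w
      ≈⟨ coeff-*A x (y +A z) w ⟩
    Σ[ splits w ] (λ s → coeff x (proj₁ s) *R coeff (y +A z) (proj₂ s))
      ≈⟨ Σ-cong (splits w) (λ s → trans (*-congˡ (coeff-+A y z (proj₂ s))) (distribˡ _ _ _)) ⟩
    Σ[ splits w ] (λ s → coeff x (proj₁ s) *R coeff y (proj₂ s) +R coeff x (proj₁ s) *R coeff z (proj₂ s))
      ≈⟨ Σ-+ (splits w) _ _ ⟩
    Σ[ splits w ] (λ s → coeff x (proj₁ s) *R coeff y (proj₂ s)) +R Σ[ splits w ] (λ s → coeff x (proj₁ s) *R coeff z (proj₂ s))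
      ≈⟨ sym (+-cong (coeff-*A x y w) (coeff-*A x z w)) ⟩
    coeff (x *A y) w +R coeff (x *A z) w
      ≈⟨ sym (coeff-+A (x *A y) (x *A z) w) ⟩
    coeff ((x *A y) +A (x *A z)) w ∎)

  *A-distribʳ : ∀ x y z → ((y +A z) *A x) ≋ ((y *A x) +A (z *A x))
  *A-distribʳ x y z = ≡⇒≋ (LP.concatMap-++ _ y z)

  *A-·ˡ : ∀ r x y → ((r · x) *A y) ≋ (r · (x *A y))
  *A-·ˡ r x y = mk (λ w → begin
    coeff ((r · x) *A y) w
      ≈⟨ coeff-*A (r · x) y w ⟩
    Σ[ splits w ] (λ s → coeff (r · x) (proj₁ s) *R coeff y (proj₂ s))
      ≈⟨ Σ-cong (splits w) (λ s → trans (*-congʳ (coeff-· r x (proj₁ s))) (*-assoc _ _ _)) ⟩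
    Σ[ splits w ] (λ s → r *R (coeff x (proj₁ s) *R coeff y (proj₂ s)))
      ≈⟨ sym (Σ-*ˡ (splits w) r _) ⟩
    r *R Σ[ splits w ] (λ s → coeff x (proj₁ s) *R coeff y (proj₂ s))
      ≈⟨ *-congˡ (sym (coeff-*A x y w)) ⟩
    r *R coeff (x *A y) w
      ≈⟨ sym (coeff-· r (x *A y) w) ⟩
    coeff (r · (x *A y)) w ∎)

  *A-·ʳ : ∀ r x y → (x *A (r · y)) ≋ (r · (x *A y))
  *A-·ʳ r x y = mk (λ w → begin
    coeff (x *A (r · y)) w
      ≈⟨ coeff-*A x (r · y) w ⟩
    Σ[ splits w ] (λ s → coeff x (proj₁ s) *R coeff (r · y) (proj₂ s))
      ≈⟨ Σ-cong (splits w) (λ s → trans (*-congˡ (coeff-· r y (proj₂ s))) (x*[r*y]≈r*[x*y] _ _)) ⟩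
    Σ[ splits w ] (λ s → r *R (coeff x (proj₁ s) *R coeff y (proj₂ s)))
      ≈⟨ sym (Σ-*ˡ (splits w) r _) ⟩
    r *R Σ[ splits w ] (λ s → coeff x (proj₁ s) *R coeff y (proj₂ s))
      ≈⟨ *-congˡ (sym (coeff-*A x y w)) ⟩
    r *R coeff (x *A y) w
      ≈⟨ sym (coeff-· r (x *A y) w) ⟩
    coeff (r · (x *A y)) w ∎)
    where
    x*[r*y]≈r*[x*y] : ∀ a b → a *R (r *R b) ≈R r *R (a *R b)
    x*[r*y]≈r*[x*y] a b = trans (sym (*-assoc a r b)) (trans (*-congʳ (*-comm a r)) (*-assoc r a b))

  *A-zeroʳ : ∀ x → (x *A 0A) ≋ 0A
  *A-zeroʳ x = mk (λ w → trans (coeff-*A x 0A w) (Σ-zero (splits w) (λ s → zeroʳ _)))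

  monomial-cong : ∀ v {a b} → a ≈R b → ((a , v) ∷ []) ≋ ((b , v) ∷ [])
  monomial-cong v a≈b = mk (λ w → +-congʳ (mono-cong v w a≈b))

  ΣA-cong : ∀ {X : Set} (F G : X → A) {xs} → All (λ x → F x ≋ G x) xs → ΣA (map F xs) ≋ ΣA (map G xs)
  ΣA-cong F G [] = ≋-refl
  ΣA-cong F G (F≋G ∷ rest) = +A-cong F≋G (ΣA-cong F G rest)

  ΣA-+A : ∀ {X : Set} (F G : X → A) xs → ΣA (map (λ x → F x +A G x) xs) ≋ (ΣA (map F xs) +A ΣA (map G xs))
  ΣA-+A F G [] = ≋-refl
  ΣA-+A F G (x ∷ xs) = ≋-trans (+A-congˡ (F x +A G x) (ΣA-+A F G xs)) (+A-interchange (F x) (G x) _ _)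

  ΣA-pairs : ∀ {X Y : Set} (h : Y → A) (f g : X → Y) xs →
             ΣA (map h (concatMap (λ x → f x ∷ g x ∷ []) xs)) ≋ ΣA (map (λ x → h (f x) +A h (g x)) xs)
  ΣA-pairs h f g [] = ≋-refl
  ΣA-pairs h f g (x ∷ xs) = ≋-trans (+A-congˡ (h (f x)) (+A-congˡ (h (g x)) (ΣA-pairs h f g xs)))
                                    (≡⇒≋ (P.sym (LP.++-assoc (h (f x)) (h (g x)) _)))

  one : A
  one = (1# , []) ∷ []

  *A-identityˡ : ∀ x → (one *A x) ≋ x
  *A-identityˡ x = ≋-trans (+A-identityʳ _) (mk (λ w → trans (reflexive (coeff-map _ x w))
    (trans (Σ-cong x (λ p → mono-cong (proj₂ p) w (*-identityˡ _))) (reflexive (P.sym (coeff-Σ x w))))))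

  prepend : Fin n → A → A
  prepend a x = map (λ p → (proj₁ p , a ∷ proj₂ p)) x

  prepend-+A : ∀ a x y → prepend a (x +A y) ≡ (prepend a x +A prepend a y)
  prepend-+A a x y = LP.map-++ _ x y

  prepend-· : ∀ a r x → prepend a (r · x) ≡ (r · prepend a x)
  prepend-· a r x = P.trans (P.sym (LP.map-∘ x)) (LP.map-∘ x)

  prepend-*A : ∀ a x y → (prepend a x *A y) ≡ prepend a (x *A y)
  prepend-*A a [] y = P.refl
  prepend-*A a (p ∷ x) y =
    P.trans (P.cong₂ _++_ (LP.map-∘ {g = λ q → (proj₁ q , a ∷ proj₂ q)} {f = λ q → (proj₁ p *R proj₁ q , proj₂ p ++ proj₂ q)} y)
                          (prepend-*A a x y))
            (P.sym (prepend-+A a _ (x *A y)))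

  -- Prepending a is multiplication by the generator t_a, hence respects ≋.
  prepend-cong : ∀ a {x y} → x ≋ y → prepend a x ≋ prepend a y
  prepend-cong a {x} {y} x≋y = ≋-trans (prepend-as-product x) (≋-trans (*A-cong (≋-refl {tₐ}) x≋y) (≋-sym (prepend-as-product y)))
    where
    tₐ : A
    tₐ = (1# , a ∷ []) ∷ []
    prepend-as-product : ∀ z → prepend a z ≋ (tₐ *A z)
    prepend-as-product z = ≋-sym (≋-trans (+A-identityʳ _) (mk (λ w → trans (reflexive (coeff-map _ z w))
      (trans (Σ-cong z (λ p → mono-cong (a ∷ proj₂ p) w (*-identityˡ _))) (reflexive (P.sym (coeff-map _ z w)))))))

  -1# : Carrier
  -1# = -R 1#

  sgn-suc : ∀ m → sgn (suc m) ≈R -R sgn m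
  sgn-suc m with isEven m
  ... | true = refl
  ... | false = sym (-‿involutive 1#)

  sgn-even : ∀ {m} → isEven m ≡ true → sgn m ≈R 1#
  sgn-even even = reflexive (P.cong (λ b → if b then 1# else -1#) even)

  sgn-odd : ∀ {m} → isEven m ≡ false → sgn m ≈R -1#
  sgn-odd odd = reflexive (P.cong (λ b → if b then 1# else -1#) odd)

  sgn-+ : ∀ m k → sgn (m + k) ≈R sgn m *R sgn k
  sgn-+ zero k = sym (*-identityˡ _)
  sgn-+ (suc m) k = begin
    sgn (suc m + k)        ≈⟨ sgn-suc (m + k) ⟩
    -R sgn (m + k)         ≈⟨ -‿cong (sgn-+ m k) ⟩
    -R (sgn m *R sgn k)    ≈⟨ -‿distribˡ-* _ _ ⟩
    (-R sgn m) *R sgn k    ≈⟨ *-congʳ (sym (sgn-suc m)) ⟩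
    sgn (suc m) *R sgn k   ∎

  sgn-square : ∀ m → sgn m *R sgn m ≈R 1#
  sgn-square m with isEven m
  ... | true = *-identityˡ 1#
  ... | false = trans (sym (-‿distribˡ-* 1# -1#)) (trans (-‿cong (*-identityˡ _)) (-‿involutive 1#))

  -1*sgn : ∀ m → -1# *R sgn m ≈R sgn (suc m)
  -1*sgn m = trans (-1*x≈-x (sgn m)) (sym (sgn-suc m))

  sgn-suc-*-1 : ∀ m → sgn (suc m) *R -1# ≈R sgn m
  sgn-suc-*-1 m = begin
    sgn (suc m) *R -1#      ≈⟨ sym (-‿distribʳ-* _ 1#) ⟩
    -R (sgn (suc m) *R 1#)  ≈⟨ -‿cong (*-identityʳ _) ⟩
    -R sgn (suc m)          ≈⟨ -‿cong (sgn-suc m) ⟩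
    -R (-R sgn m)           ≈⟨ -‿involutive _ ⟩
    sgn m                   ∎

module WordPolynomials {c ℓ} (R : CommutativeRing c ℓ) (n : ℕ) (q : CommutativeRing.Carrier R) where
  open CommutativeRing R renaming (_+_ to _+R_; _*_ to _*R_; -_ to -R_; _≈_ to _≈R_)
  open FreeAlg R n
  open FreeAlgebraLaws R n
  open import Algebra.Properties.Ring ring using (-‿involutive; -‿distribˡ-*; -‿distribʳ-*)
  open import Algebra.Solver.CommutativeMonoid +A-commutativeMonoid using (solve; _⊕_; _⊜_)
  open import Relation.Binary.Reasoning.Setoid ≋-setoid

  -- For a word w = j₁ ⋯ j_m these are Σ_{I ⊆ w, #I even/odd} (-1)^{ℓ(I)} (-q)^{⌊#I/2⌋} t_{w∖I},
  -- computed by splitting off the first letter (Bridge below makes this precise).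
  mutual
    t⁺ : Word → A
    t⁺ [] = one
    t⁺ (a ∷ w) = prepend a (t⁺ w) +A ((-R q) · t⁻ w)

    t⁻ : Word → A
    t⁻ [] = 0A
    t⁻ (a ∷ w) = t⁺ w +A (-1# · prepend a (t⁻ w))

  -- The product formula for t^± of a concatenation: t^± multiply like the even and
  -- odd parts of a super-commutative product, the odd part of u carrying the sign (-1)^|u|.
  ConcatLaw : Word → Word → Set ℓ
  ConcatLaw u v = (t⁺ (u ++ v) ≋ ((t⁺ u *A t⁺ v) +A ((sgn (length u) *R q) · (t⁻ u *A t⁻ v))))
                × (t⁻ (u ++ v) ≋ ((t⁻ u *A t⁺ v) +A (sgn (length u) · (t⁺ u *A t⁻ v))))

  +A-shuffle : ∀ a b c d → ((a +A b) +A (c +A d)) ≋ ((a +A c) +A (d +A b))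
  +A-shuffle = solve 4 (λ a b c d → (a ⊕ b) ⊕ (c ⊕ d) ⊜ (a ⊕ c) ⊕ (d ⊕ b)) ≋-refl

  concat-t⁺-step : ∀ a u v → ConcatLaw u v →
    t⁺ (a ∷ u ++ v) ≋ ((t⁺ (a ∷ u) *A t⁺ v) +A ((sgn (suc (length u)) *R q) · (t⁻ (a ∷ u) *A t⁻ v)))
  concat-t⁺-step a u v (ih⁺ , ih⁻) = begin
    prepend a (t⁺ (u ++ v)) +A ((-R q) · t⁻ (u ++ v))
      ≈⟨ +A-cong (prepend-cong a ih⁺) (·-congʳ (-R q) ih⁻) ⟩
    prepend a (EE +A ((s *R q) · OO)) +A ((-R q) · (OE +A (s · EO)))
      ≡⟨ P.cong₂ _+A_ (P.trans (prepend-+A a EE ((s *R q) · OO)) (P.cong (prepend a EE +A_) (prepend-· a (s *R q) OO)))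
                       (·-+A (-R q) OE (s · EO)) ⟩
    (prepend a EE +A ((s *R q) · prepend a OO)) +A (((-R q) · OE) +A ((-R q) · (s · EO)))
      ≈⟨ +A-shuffle (prepend a EE) _ _ _ ⟩
    (prepend a EE +A ((-R q) · OE)) +A (((-R q) · (s · EO)) +A ((s *R q) · prepend a OO))
      ≈⟨ +A-congˡ (prepend a EE +A ((-R q) · OE)) (+A-cong (·-· (-R q) s EO -q*s≈s'*q) (≋-sym (·-· (s' *R q) -1# (prepend a OO) s'*q*-1≈s*q))) ⟩
    (prepend a EE +A ((-R q) · OE)) +A (((s' *R q) · EO) +A ((s' *R q) · (-1# · prepend a OO)))
      ≡⟨ P.sym (P.cong₂ _+A_ (P.cong (_+A ((-R q) · OE)) (prepend-*A a (t⁺ u) (t⁺ v))) (·-+A (s' *R q) EO (-1# · prepend a OO))) ⟩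
    ((prepend a (t⁺ u) *A t⁺ v) +A ((-R q) · OE)) +A ((s' *R q) · (EO +A (-1# · prepend a OO)))
      ≈⟨ +A-cong (+A-congˡ (prepend a (t⁺ u) *A t⁺ v) (≋-sym (*A-·ˡ (-R q) (t⁻ u) (t⁺ v))))
                 (·-congʳ (s' *R q) (+A-congˡ EO (≋-trans (·-congʳ -1# (≡⇒≋ (P.sym (prepend-*A a (t⁻ u) (t⁻ v)))))
                                                          (≋-sym (*A-·ˡ -1# (prepend a (t⁻ u)) (t⁻ v)))))) ⟩
    ((prepend a (t⁺ u) *A t⁺ v) +A (((-R q) · t⁻ u) *A t⁺ v))
      +A ((s' *R q) · ((t⁺ u *A t⁻ v) +A ((-1# · prepend a (t⁻ u)) *A t⁻ v)))
      ≈⟨ +A-cong (≋-sym (*A-distribʳ (t⁺ v) (prepend a (t⁺ u)) ((-R q) · t⁻ u)))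
                 (·-congʳ (s' *R q) (≋-sym (*A-distribʳ (t⁻ v) (t⁺ u) (-1# · prepend a (t⁻ u))))) ⟩
    (t⁺ (a ∷ u) *A t⁺ v) +A ((s' *R q) · (t⁻ (a ∷ u) *A t⁻ v)) ∎
    where
    s = sgn (length u)
    s' = sgn (suc (length u))
    EE = t⁺ u *A t⁺ v
    OO = t⁻ u *A t⁻ v
    OE = t⁻ u *A t⁺ v
    EO = t⁺ u *A t⁻ v
    -q*s≈s'*q : (-R q) *R s ≈R s' *R q
    -q*s≈s'*q = trans (sym (-‿distribˡ-* q s)) (trans (-‿cong (*-comm q s))
                  (trans (-‿distribˡ-* s q) (*-congʳ (sym (sgn-suc (length u))))))
    s'*q*-1≈s*q : (s' *R q) *R -1# ≈R s *R q
    s'*q*-1≈s*q = trans (*-assoc s' q -1#) (trans (*-congˡ (*-comm q -1#))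
                    (trans (sym (*-assoc s' -1# q)) (*-congʳ (sgn-suc-*-1 (length u)))))

  concat-t⁻-step : ∀ a u v → ConcatLaw u v →
    t⁻ (a ∷ u ++ v) ≋ ((t⁻ (a ∷ u) *A t⁺ v) +A (sgn (suc (length u)) · (t⁺ (a ∷ u) *A t⁻ v)))
  concat-t⁻-step a u v (ih⁺ , ih⁻) = begin
    t⁺ (u ++ v) +A (-1# · prepend a (t⁻ (u ++ v)))
      ≈⟨ +A-cong ih⁺ (·-congʳ -1# (prepend-cong a ih⁻)) ⟩
    (EE +A ((s *R q) · OO)) +A (-1# · prepend a (OE +A (s · EO)))
      ≡⟨ P.cong ((EE +A ((s *R q) · OO)) +A_) (P.trans (P.cong (-1# ·_) (P.trans (prepend-+A a OE (s · EO)) (P.cong (prepend a OE +A_) (prepend-· a s EO))))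
                                 (·-+A -1# (prepend a OE) (s · prepend a EO))) ⟩
    (EE +A ((s *R q) · OO)) +A ((-1# · prepend a OE) +A (-1# · (s · prepend a EO)))
      ≈⟨ +A-shuffle EE _ _ _ ⟩
    (EE +A (-1# · prepend a OE)) +A ((-1# · (s · prepend a EO)) +A ((s *R q) · OO))
      ≈⟨ +A-congˡ (EE +A (-1# · prepend a OE)) (+A-cong (·-· -1# s (prepend a EO) (-1*sgn (length u)))
                            (≋-sym (·-· s' (-R q) OO s'*-q≈s*q))) ⟩
    (EE +A (-1# · prepend a OE)) +A ((s' · prepend a EO) +A (s' · ((-R q) · OO)))
      ≡⟨ P.sym (P.cong₂ _+A_ (P.cong (λ z → EE +A (-1# · z)) (prepend-*A a (t⁻ u) (t⁺ v)))
                             (P.trans (·-+A s' (prepend a (t⁺ u) *A t⁻ v) ((-R q) · OO))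
                                      (P.cong (λ z → (s' · z) +A (s' · ((-R q) · OO))) (prepend-*A a (t⁺ u) (t⁻ v))))) ⟩
    (EE +A (-1# · (prepend a (t⁻ u) *A t⁺ v))) +A (s' · ((prepend a (t⁺ u) *A t⁻ v) +A ((-R q) · OO)))
      ≈⟨ +A-cong (+A-congˡ EE (≋-sym (*A-·ˡ -1# (prepend a (t⁻ u)) (t⁺ v))))
                 (·-congʳ s' (+A-congˡ (prepend a (t⁺ u) *A t⁻ v) (≋-sym (*A-·ˡ (-R q) (t⁻ u) (t⁻ v))))) ⟩
    (EE +A ((-1# · prepend a (t⁻ u)) *A t⁺ v)) +A (s' · ((prepend a (t⁺ u) *A t⁻ v) +A (((-R q) · t⁻ u) *A t⁻ v)))
      ≈⟨ +A-cong (≋-sym (*A-distribʳ (t⁺ v) (t⁺ u) (-1# · prepend a (t⁻ u))))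
                 (·-congʳ s' (≋-sym (*A-distribʳ (t⁻ v) (prepend a (t⁺ u)) ((-R q) · t⁻ u)))) ⟩
    (t⁻ (a ∷ u) *A t⁺ v) +A (s' · (t⁺ (a ∷ u) *A t⁻ v)) ∎
    where
    s = sgn (length u)
    s' = sgn (suc (length u))
    EE = t⁺ u *A t⁺ v
    OO = t⁻ u *A t⁻ v
    OE = t⁻ u *A t⁺ v
    EO = t⁺ u *A t⁻ v
    s'*-q≈s*q : s' *R (-R q) ≈R s *R q
    s'*-q≈s*q = trans (*-congʳ (sgn-suc (length u))) (trans (sym (-‿distribˡ-* s (-R q)))
                  (trans (-‿cong (sym (-‿distribʳ-* s q))) (-‿involutive _)))

  concatenation : ∀ u v → ConcatLaw u v
  concatenation [] v = ≋-sym (≋-trans (+A-identityʳ _) (*A-identityˡ (t⁺ v)))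
                     , ≋-sym (≋-trans (·-identity _) (*A-identityˡ (t⁻ v)))
  concatenation (a ∷ u) v = concat-t⁺-step a u v (concatenation u v) , concat-t⁻-step a u v (concatenation u v)

  -- The alternating deletion sum Σ_{i=1}^{m} (-1)^{i-1} G(w₁⋯ŵᵢ⋯w_m) of w = w₁⋯w_m,
  -- by recursion on the first letter.
  altDel : (Word → A) → Word → A
  altDel G [] = 0A
  altDel G (a ∷ w) = G w +A (-1# · altDel (λ r → G (a ∷ r)) w)

  altDel-cong : ∀ F G w → (∀ r → suc (length r) ≡ length w → F r ≋ G r) → altDel F w ≋ altDel G w
  altDel-cong F G [] F≋G = ≋-refl
  altDel-cong F G (a ∷ w) F≋G =
    +A-cong (F≋G w P.refl) (·-congʳ -1# (altDel-cong (λ r → F (a ∷ r)) (λ r → G (a ∷ r)) w (λ r e → F≋G (a ∷ r) (P.cong suc e))))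

  altDel-+A : ∀ F G w → altDel (λ r → F r +A G r) w ≋ (altDel F w +A altDel G w)
  altDel-+A F G [] = ≋-refl
  altDel-+A F G (a ∷ w) = begin
    (F w +A G w) +A (-1# · altDel (λ r → F (a ∷ r) +A G (a ∷ r)) w)
      ≈⟨ +A-congˡ (F w +A G w) (·-congʳ -1# (altDel-+A F' G' w)) ⟩
    (F w +A G w) +A (-1# · (altDel F' w +A altDel G' w))
      ≡⟨ P.cong ((F w +A G w) +A_) (·-+A -1# (altDel F' w) (altDel G' w)) ⟩
    (F w +A G w) +A ((-1# · altDel F' w) +A (-1# · altDel G' w))
      ≈⟨ +A-interchange (F w) (G w) _ _ ⟩
    (F w +A (-1# · altDel F' w)) +A (G w +A (-1# · altDel G' w)) ∎
    where
    F' = λ r → F (a ∷ r)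
    G' = λ r → G (a ∷ r)

  record Additive (φ : A → A) : Set (c ⊔ ℓ) where
    field
      φ-cong : ∀ {x y} → x ≋ y → φ x ≋ φ y
      φ-0A : φ 0A ≋ 0A
      φ-+A : ∀ x y → φ (x +A y) ≋ (φ x +A φ y)
      φ-neg : ∀ x → φ (-1# · x) ≋ (-1# · φ x)

  altDel-additive : ∀ {φ} → Additive φ → ∀ G w → altDel (λ r → φ (G r)) w ≋ φ (altDel G w)
  altDel-additive {φ} additive G [] = ≋-sym (Additive.φ-0A additive)
  altDel-additive {φ} additive G (a ∷ w) = begin
    φ (G w) +A (-1# · altDel (λ r → φ (G (a ∷ r))) w)
      ≈⟨ +A-congˡ (φ (G w)) (·-congʳ -1# (altDel-additive additive (λ r → G (a ∷ r)) w)) ⟩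
    φ (G w) +A (-1# · φ (altDel (λ r → G (a ∷ r)) w))
      ≈⟨ +A-congˡ (φ (G w)) (≋-sym (φ-neg _)) ⟩
    φ (G w) +A φ (-1# · altDel (λ r → G (a ∷ r)) w)
      ≈⟨ ≋-sym (φ-+A _ _) ⟩
    φ (G w +A (-1# · altDel (λ r → G (a ∷ r)) w)) ∎
    where open Additive additive

  prepend-additive : ∀ a → Additive (prepend a)
  prepend-additive a = record
    { φ-cong = prepend-cong a ; φ-0A = ≋-refl
    ; φ-+A = λ x y → ≡⇒≋ (prepend-+A a x y) ; φ-neg = λ x → ≡⇒≋ (prepend-· a -1# x) }

  scale-additive : ∀ k → Additive (k ·_)
  scale-additive k = record
    { φ-cong = ·-congʳ k ; φ-0A = ≋-refl
    ; φ-+A = λ x y → ≡⇒≋ (·-+A k x y) ; φ-neg = λ x → ·-comm k -1# x }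

  left-mult-additive : ∀ x → Additive (x *A_)
  left-mult-additive x = record
    { φ-cong = *A-cong (≋-refl {x}) ; φ-0A = *A-zeroʳ x
    ; φ-+A = *A-distribˡ x ; φ-neg = λ y → *A-·ʳ -1# x y }

  right-mult-additive : ∀ x → Additive (_*A x)
  right-mult-additive x = record
    { φ-cong = λ p → *A-cong p (≋-refl {x}) ; φ-0A = ≋-refl
    ; φ-+A = λ y z → *A-distribʳ x y z ; φ-neg = λ y → *A-·ˡ -1# y x }

  altDel-t± : ∀ w → (altDel t⁺ w ≋ t⁻ w) × (altDel t⁻ w ≋ 0A)
  altDel-t± [] = ≋-refl , ≋-refl
  altDel-t± (a ∷ w) = ∂t⁺ , ∂t⁻
    where
    ih = altDel-t± w
    ∂t⁺ : altDel t⁺ (a ∷ w) ≋ t⁻ (a ∷ w)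
    ∂t⁺ = begin
      t⁺ w +A (-1# · altDel (λ r → prepend a (t⁺ r) +A ((-R q) · t⁻ r)) w)
        ≈⟨ +A-congˡ (t⁺ w) (·-congʳ -1# (≋-trans (altDel-+A (λ r → prepend a (t⁺ r)) (λ r → (-R q) · t⁻ r) w)
             (+A-cong (≋-trans (altDel-additive (prepend-additive a) t⁺ w) (prepend-cong a (proj₁ ih)))
                      (≋-trans (altDel-additive (scale-additive (-R q)) t⁻ w) (·-congʳ (-R q) (proj₂ ih)))))) ⟩
      t⁺ w +A (-1# · (prepend a (t⁻ w) +A 0A))
        ≈⟨ +A-congˡ (t⁺ w) (·-congʳ -1# (+A-identityʳ (prepend a (t⁻ w)))) ⟩
      t⁺ w +A (-1# · prepend a (t⁻ w)) ∎
    ∂t⁻ : altDel t⁻ (a ∷ w) ≋ 0A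
    ∂t⁻ = begin
      t⁻ w +A (-1# · altDel (λ r → t⁺ r +A (-1# · prepend a (t⁻ r))) w)
        ≈⟨ +A-congˡ (t⁻ w) (·-congʳ -1# (≋-trans (altDel-+A t⁺ (λ r → -1# · prepend a (t⁻ r)) w)
             (+A-cong (proj₁ ih) (≋-trans (altDel-additive (scale-additive -1#) (λ r → prepend a (t⁻ r)) w)
               (·-congʳ -1# (≋-trans (altDel-additive (prepend-additive a) t⁻ w) (prepend-cong a (proj₂ ih)))))))) ⟩
      t⁻ w +A (-1# · (t⁻ w +A 0A))
        ≈⟨ +A-congˡ (t⁻ w) (·-congʳ -1# (+A-identityʳ (t⁻ w))) ⟩
      t⁻ w +A (-1# · t⁻ w)
        ≈⟨ ·-inverse (t⁻ w) ⟩
      0A ∎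

  delete-right : ∀ u v → altDel (λ r → t⁻ (u ++ r)) v ≋ (t⁻ u *A t⁻ v)
  delete-right u v = begin
    altDel (λ r → t⁻ (u ++ r)) v
      ≈⟨ altDel-cong _ _ v (λ r _ → proj₂ (concatenation u r)) ⟩
    altDel (λ r → (t⁻ u *A t⁺ r) +A (s · (t⁺ u *A t⁻ r))) v
      ≈⟨ altDel-+A (λ r → t⁻ u *A t⁺ r) (λ r → s · (t⁺ u *A t⁻ r)) v ⟩
    altDel (λ r → t⁻ u *A t⁺ r) v +A altDel (λ r → s · (t⁺ u *A t⁻ r)) v
      ≈⟨ +A-cong (altDel-additive (left-mult-additive (t⁻ u)) t⁺ v)
                 (≋-trans (altDel-additive (scale-additive s) (λ r → t⁺ u *A t⁻ r) v)
                          (·-congʳ s (altDel-additive (left-mult-additive (t⁺ u)) t⁻ v))) ⟩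
    (t⁻ u *A altDel t⁺ v) +A (s · (t⁺ u *A altDel t⁻ v))
      ≈⟨ +A-cong (*A-cong (≋-refl {t⁻ u}) (proj₁ (altDel-t± v)))
                 (·-congʳ s (≋-trans (*A-cong (≋-refl {t⁺ u}) (proj₂ (altDel-t± v))) (*A-zeroʳ (t⁺ u)))) ⟩
    (t⁻ u *A t⁻ v) +A 0A
      ≈⟨ +A-identityʳ (t⁻ u *A t⁻ v) ⟩
    t⁻ u *A t⁻ v ∎
    where s = sgn (length u)

  -- The alternating deletion sum with signs counted from the right: Σ_{i=1}^{m} (-1)^{m-i} G(w₁⋯ŵᵢ⋯w_m).
  altDelʳ : (Word → A) → Word → A
  altDelʳ G [] = 0A
  altDelʳ G (a ∷ w) = (sgn (length w) · G w) +A altDelʳ (λ r → G (a ∷ r)) w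

  altDelʳ-altDel : ∀ G a w → altDelʳ G (a ∷ w) ≋ (sgn (length w) · altDel G (a ∷ w))
  altDelʳ-altDel G a [] = ≋-sym (≡⇒≋ (·-+A (sgn 0) (G []) 0A))
  altDelʳ-altDel G a (b ∷ w) = begin
    (s' · G (b ∷ w)) +A altDelʳ (λ r → G (a ∷ r)) (b ∷ w)
      ≈⟨ +A-congˡ (s' · G (b ∷ w)) (altDelʳ-altDel (λ r → G (a ∷ r)) b w) ⟩
    (s' · G (b ∷ w)) +A (sgn (length w) · altDel (λ r → G (a ∷ r)) (b ∷ w))
      ≈⟨ +A-congˡ (s' · G (b ∷ w)) (≋-sym (·-· s' -1# _ (sgn-suc-*-1 (length w)))) ⟩
    (s' · G (b ∷ w)) +A (s' · (-1# · altDel (λ r → G (a ∷ r)) (b ∷ w)))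
      ≡⟨ P.sym (·-+A s' (G (b ∷ w)) _) ⟩
    s' · altDel G (a ∷ b ∷ w) ∎
    where s' = sgn (suc (length w))

  delete-left : ∀ u v → altDelʳ (λ r → t⁻ (r ++ v)) u ≋ (t⁻ u *A t⁻ v)
  delete-left [] v = ≋-refl
  delete-left (a ∷ u) v = begin
    altDelʳ (λ r → t⁻ (r ++ v)) (a ∷ u)
      ≈⟨ altDelʳ-altDel (λ r → t⁻ (r ++ v)) a u ⟩
    s · altDel (λ r → t⁻ (r ++ v)) (a ∷ u)
      ≈⟨ ·-congʳ s (altDel-cong _ _ (a ∷ u) (λ r e → P.subst (λ m → t⁻ (r ++ v) ≋ ((t⁻ r *A t⁺ v) +A (sgn m · (t⁺ r *A t⁻ v))))
                                                          (NP.suc-injective e) (proj₂ (concatenation r v)))) ⟩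
    s · altDel (λ r → (t⁻ r *A t⁺ v) +A (s · (t⁺ r *A t⁻ v))) (a ∷ u)
      ≈⟨ ·-congʳ s (≋-trans (altDel-+A (λ r → t⁻ r *A t⁺ v) (λ r → s · (t⁺ r *A t⁻ v)) (a ∷ u))
           (+A-cong (altDel-additive (right-mult-additive (t⁺ v)) t⁻ (a ∷ u))
                    (≋-trans (altDel-additive (scale-additive s) (λ r → t⁺ r *A t⁻ v) (a ∷ u))
                             (·-congʳ s (altDel-additive (right-mult-additive (t⁻ v)) t⁺ (a ∷ u)))))) ⟩
    s · ((altDel t⁻ (a ∷ u) *A t⁺ v) +A (s · (altDel t⁺ (a ∷ u) *A t⁻ v)))
      ≈⟨ ·-congʳ s (+A-cong (*A-cong (proj₂ (altDel-t± (a ∷ u))) (≋-refl {t⁺ v}))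
                            (·-congʳ s (*A-cong (proj₁ (altDel-t± (a ∷ u))) (≋-refl {t⁻ v})))) ⟩
    s · (0A +A (s · (t⁻ (a ∷ u) *A t⁻ v)))
      ≈⟨ ·-· s s _ (sgn-square (length u)) ⟩
    1# · (t⁻ (a ∷ u) *A t⁻ v)
      ≈⟨ ·-identity _ ⟩
    t⁻ (a ∷ u) *A t⁻ v ∎
    where s = sgn (length u)

module Bridge {c ℓ} (R : CommutativeRing c ℓ) (q : CommutativeRing.Carrier R) where
  open CommutativeRing R hiding (_-_) renaming (_+_ to _+R_; _*_ to _*R_; -_ to -R_; _≈_ to _≈R_)

  module At (n : ℕ) where
    open FreeAlg R n public
    open FreeAlgebraLaws R n public
    open WordPolynomials R n q public

    oddTerm : Subset n → Subset n → A
    oddTerm J I = if isEven ∣ I ∣ then 0A else ((sgn (ellJ J I) *R pow (-R q) ⌊ ∣ I ∣ ∸ 1 /2⌋) · t (J ─ I))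

    evenTerm : Subset n → Subset n → A
    evenTerm J I = if isEven ∣ I ∣ then ((sgn (ellJ J I) *R pow (-R q) ⌊ ∣ I ∣ /2⌋) · t (J ─ I)) else 0A

    tPlus : Subset n → A
    tPlus J = ΣA (map (evenTerm J) (subsetsOf J))

    Bridged : Subset n → Set ℓ
    Bridged J = (tMinus q J ≋ t⁻ (elems J)) × (tPlus J ≋ t⁺ (elems J))

  module Step (n : ℕ) where
    module S = At n
    open At (suc n)

    shift : S.A → A
    shift x = map (λ p → (proj₁ p , map F.suc (proj₂ p))) x

    unshift : (w : Word) → Σ S.Word (λ v → map F.suc v ≡ w) ⊎ (∀ v → map F.suc v ≢ w)
    unshift [] = inj₁ ([] , P.refl)
    unshift (F.zero ∷ w) = inj₂ (λ { [] () ; (x ∷ v) () })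
    unshift (F.suc x ∷ w) with unshift w
    ... | inj₁ (v , eq) = inj₁ (x ∷ v , P.cong (F.suc x ∷_) eq)
    ... | inj₂ none = inj₂ (λ { [] () ; (y ∷ v) eq → none v (LP.∷-injectiveʳ eq) })

    coeff-shift-image : ∀ x w → coeff (shift x) (map F.suc w) ≈R S.coeff x w
    coeff-shift-image [] w = refl
    coeff-shift-image ((a , v) ∷ x) w = +-cong (by-cases (LP.≡-dec FP._≟_ v w)) (coeff-shift-image x w)
      where
      by-cases : Dec (v ≡ w) → mono (map F.suc v) (map F.suc w) a ≈R S.mono v w a
      by-cases (yes eq) = reflexive (P.trans (mono-≡ _ _ a (P.cong (map F.suc) eq)) (P.sym (S.mono-≡ v w a eq)))
      by-cases (no v≢w) = reflexive (P.trans (mono-≢ _ _ a (λ eq → v≢w (LP.map-injective FP.suc-injective eq)))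
                                             (P.sym (S.mono-≢ v w a v≢w)))

    coeff-shift-other : ∀ x w → (∀ v → map F.suc v ≢ w) → coeff (shift x) w ≈R 0#
    coeff-shift-other [] w none = refl
    coeff-shift-other ((a , v) ∷ x) w none =
      trans (+-cong (reflexive (mono-≢ _ _ a (none v))) (coeff-shift-other x w none)) (+-identityˡ 0#)

    shift-cong : ∀ {x y} → x S.≋ y → shift x ≋ shift y
    shift-cong {x} {y} (S.mk x≈y) = mk λ w → by-cases w (unshift w)
      where
      by-cases : ∀ w → Σ S.Word (λ v → map F.suc v ≡ w) ⊎ (∀ v → map F.suc v ≢ w) →
                 coeff (shift x) w ≈R coeff (shift y) w
      by-cases w (inj₁ (v , P.refl)) = trans (coeff-shift-image x v) (trans (x≈y v) (sym (coeff-shift-image y v)))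
      by-cases w (inj₂ none) = trans (coeff-shift-other x w none) (sym (coeff-shift-other y w none))

    shift-+A : ∀ x y → shift (x S.+A y) ≡ (shift x +A shift y)
    shift-+A x y = LP.map-++ _ x y

    shift-· : ∀ r x → shift (r S.· x) ≡ (r · shift x)
    shift-· r x = P.trans (P.sym (LP.map-∘ x)) (LP.map-∘ x)

    shift-prepend : ∀ a x → shift (S.prepend a x) ≡ prepend (F.suc a) (shift x)
    shift-prepend a x = P.trans (P.sym (LP.map-∘ x)) (LP.map-∘ x)

    shift-t± : ∀ w → (shift (S.t⁺ w) ≡ t⁺ (map F.suc w)) × (shift (S.t⁻ w) ≡ t⁻ (map F.suc w))
    shift-t± [] = P.refl , P.refl
    shift-t± (a ∷ w) =
      P.trans (shift-+A (S.prepend a (S.t⁺ w)) _)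
              (P.cong₂ _+A_ (P.trans (shift-prepend a _) (P.cong (prepend (F.suc a)) (proj₁ ih)))
                            (P.trans (shift-· _ _) (P.cong ((-R q) ·_) (proj₂ ih))))
      , P.trans (shift-+A (S.t⁺ w) _)
                (P.cong₂ _+A_ (proj₁ ih) (P.trans (shift-· _ _)
                  (P.cong (-1# ·_) (P.trans (shift-prepend a _) (P.cong (prepend (F.suc a)) (proj₂ ih))))))
      where ih = shift-t± w

    -- shift, prepend and scalar multiplication all act termwise, hence commute with sums of families.
    ΣA-shift : ∀ {X : Set} (G : X → S.A) xs → ΣA (map (λ x → shift (G x)) xs) ≡ shift (S.ΣA (map G xs))
    ΣA-shift G xs = concat-map-family _ G xs

    ΣA-prepend : ∀ {X : Set} a (G : X → A) xs → ΣA (map (λ x → prepend a (G x)) xs) ≡ prepend a (ΣA (map G xs))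
    ΣA-prepend a G xs = concat-map-family _ G xs

    ΣA-· : ∀ {X : Set} r (G : X → A) xs → ΣA (map (λ x → r · G x) xs) ≡ (r · ΣA (map G xs))
    ΣA-· r G xs = concat-map-family _ G xs

    pow-shift : ∀ r k → pow r k ≡ S.pow r k
    pow-shift r zero = P.refl
    pow-shift r (suc k) = P.cong (r *R_) (pow-shift r k)

    odd-outside : ∀ J I → oddTerm (false ∷ J) (false ∷ I) ≋ shift (S.oddTerm J I)
    odd-outside J I with isEven ∣ I ∣
    ... | true = ≋-refl
    ... | false = monomial-cong _ (*-congʳ (*-cong (reflexive (P.cong sgn (ell-outside J I))) (reflexive (pow-shift (-R q) ⌊ ∣ I ∣ ∸ 1 /2⌋))))

    even-outside : ∀ J I → evenTerm (false ∷ J) (false ∷ I) ≋ shift (S.evenTerm J I)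
    even-outside J I with isEven ∣ I ∣
    ... | true = monomial-cong _ (*-congʳ (*-cong (reflexive (P.cong sgn (ell-outside J I))) (reflexive (pow-shift (-R q) ⌊ ∣ I ∣ /2⌋))))
    ... | false = ≋-refl

    odd-skip : ∀ J I → RankBounded J I → oddTerm (true ∷ J) (false ∷ I) ≋ (-1# · prepend F.zero (shift (S.oddTerm J I)))
    odd-skip J I bounded with isEven ∣ I ∣ in odd
    ... | true = ≋-refl
    ... | false = monomial-cong _ (begin
      (sgn (ellJ (true ∷ J) (false ∷ I)) *R pow (-R q) k) *R 1#
        ≈⟨ *-congʳ (*-cong (trans (reflexive (P.cong sgn (ell-skip J I bounded))) (sgn-+ ∣ I ∣ (ellJ J I)))
                           (reflexive (pow-shift (-R q) k))) ⟩
      ((sgn ∣ I ∣ *R sgn (ellJ J I)) *R S.pow (-R q) k) *R 1#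
        ≈⟨ *-congʳ (*-congʳ (*-congʳ (sgn-odd {∣ I ∣} odd))) ⟩
      ((-1# *R sgn (ellJ J I)) *R S.pow (-R q) k) *R 1#
        ≈⟨ trans (*-congʳ (*-assoc _ _ _)) (*-assoc _ _ _) ⟩
      -1# *R ((sgn (ellJ J I) *R S.pow (-R q) k) *R 1#) ∎)
      where
      open import Relation.Binary.Reasoning.Setoid setoid
      k = ⌊ ∣ I ∣ ∸ 1 /2⌋

    even-skip : ∀ J I → RankBounded J I → evenTerm (true ∷ J) (false ∷ I) ≋ prepend F.zero (shift (S.evenTerm J I))
    even-skip J I bounded with isEven ∣ I ∣ in even
    ... | false = ≋-refl
    ... | true = monomial-cong _ (*-congʳ (*-cong
      (trans (reflexive (P.cong sgn (ell-skip J I bounded)))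
             (trans (sgn-+ ∣ I ∣ (ellJ J I)) (trans (*-congʳ (sgn-even {∣ I ∣} even)) (*-identityˡ _))))
      (reflexive (pow-shift (-R q) ⌊ ∣ I ∣ /2⌋))))

    odd-keep : ∀ J I → oddTerm (true ∷ J) (true ∷ I) ≋ shift (S.evenTerm J I)
    odd-keep J I with isEven ∣ I ∣
    ... | true = monomial-cong _ (*-congʳ (*-cong (reflexive (P.cong sgn (ell-inside J I))) (reflexive (pow-shift (-R q) ⌊ ∣ I ∣ /2⌋))))
    ... | false = ≋-refl

    even-keep : ∀ J I → evenTerm (true ∷ J) (true ∷ I) ≋ ((-R q) · shift (S.oddTerm J I))
    even-keep J I with isEven ∣ I ∣ in odd
    ... | true = ≋-refl
    ... | false = monomial-cong _ (begin
      (sgn (ellJ (true ∷ J) (true ∷ I)) *R pow (-R q) ⌊ suc ∣ I ∣ /2⌋) *R 1#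
        ≈⟨ *-congʳ (*-cong (reflexive (P.cong sgn (ell-inside J I))) (reflexive (pow-half ∣ I ∣ odd))) ⟩
      (sgn (ellJ J I) *R ((-R q) *R S.pow (-R q) k)) *R 1#
        ≈⟨ *-congʳ (trans (sym (*-assoc _ _ _)) (trans (*-congʳ (*-comm _ _)) (*-assoc _ _ _))) ⟩
      ((-R q) *R (sgn (ellJ J I) *R S.pow (-R q) k)) *R 1#
        ≈⟨ *-assoc _ _ _ ⟩
      (-R q) *R ((sgn (ellJ J I) *R S.pow (-R q) k) *R 1#) ∎)
      where
      open import Relation.Binary.Reasoning.Setoid setoid
      k = ⌊ ∣ I ∣ ∸ 1 /2⌋
      pow-half : ∀ m → isEven m ≡ false → pow (-R q) ⌊ suc m /2⌋ ≡ (-R q) *R S.pow (-R q) ⌊ m ∸ 1 /2⌋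
      pow-half zero ()
      pow-half (suc m) _ = P.cong ((-R q) *R_) (pow-shift (-R q) ⌊ m /2⌋)

    sum-outside : ∀ J (T : Subset (suc n) → A) (T₀ : Subset n → S.A) → (∀ I → T (false ∷ I) ≋ shift (T₀ I)) →
                  ΣA (map T (subsetsOf (false ∷ J))) ≋ shift (S.ΣA (map T₀ (subsetsOf J)))
    sum-outside J T T₀ T≋ = begin
      ΣA (map T (map (false ∷_) (subsetsOf J)))      ≡⟨ P.cong ΣA (P.sym (LP.map-∘ (subsetsOf J))) ⟩
      ΣA (map (λ I → T (false ∷ I)) (subsetsOf J))   ≈⟨ ΣA-cong _ _ (All.universal T≋ (subsetsOf J)) ⟩
      ΣA (map (λ I → shift (T₀ I)) (subsetsOf J))    ≡⟨ ΣA-shift T₀ (subsetsOf J) ⟩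
      shift (S.ΣA (map T₀ (subsetsOf J)))            ∎
      where open import Relation.Binary.Reasoning.Setoid ≋-setoid

    sum-inside : ∀ J (T : Subset (suc n) → A) (skip keep : Subset n → A) →
                 All (λ I → T (false ∷ I) ≋ skip I) (subsetsOf J) → (∀ I → T (true ∷ I) ≋ keep I) →
                 ΣA (map T (subsetsOf (true ∷ J))) ≋ (ΣA (map skip (subsetsOf J)) +A ΣA (map keep (subsetsOf J)))
    sum-inside J T skip keep T≋skip T≋keep = begin
      ΣA (map T (concatMap (λ I → (false ∷ I) ∷ (true ∷ I) ∷ []) (subsetsOf J)))
        ≈⟨ ΣA-pairs T (false ∷_) (true ∷_) (subsetsOf J) ⟩
      ΣA (map (λ I → T (false ∷ I) +A T (true ∷ I)) (subsetsOf J))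
        ≈⟨ ΣA-cong _ _ (All.map (λ T≋ → +A-cong T≋ (T≋keep _)) T≋skip) ⟩
      ΣA (map (λ I → skip I +A keep I) (subsetsOf J))
        ≈⟨ ΣA-+A skip keep (subsetsOf J) ⟩
      ΣA (map skip (subsetsOf J)) +A ΣA (map keep (subsetsOf J)) ∎
      where open import Relation.Binary.Reasoning.Setoid ≋-setoid

    step-outside : ∀ J → S.Bridged J → Bridged (false ∷ J)
    step-outside J (ih⁻ , ih⁺) =
        ≋-trans (sum-outside J (oddTerm (false ∷ J)) (S.oddTerm J) (odd-outside J))
                (≋-trans (shift-cong ih⁻) (≡⇒≋ (proj₂ (shift-t± (elems J)))))
      , ≋-trans (sum-outside J (evenTerm (false ∷ J)) (S.evenTerm J) (even-outside J))
                (≋-trans (shift-cong ih⁺) (≡⇒≋ (proj₁ (shift-t± (elems J)))))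

    step-inside : ∀ J → S.Bridged J → Bridged (true ∷ J)
    step-inside J (ih⁻ , ih⁺) = odd , even
      where
      open import Relation.Binary.Reasoning.Setoid ≋-setoid
      subs = subsetsOf J
      w = map F.suc (elems J)
      bounded = subsets-rankBounded J
      odd : tMinus q (true ∷ J) ≋ t⁻ (F.zero ∷ w)
      odd = begin
        tMinus q (true ∷ J)
          ≈⟨ sum-inside J (oddTerm (true ∷ J)) (λ I → -1# · prepend F.zero (shift (S.oddTerm J I))) (λ I → shift (S.evenTerm J I))
                        (All.map (λ {I} → odd-skip J I) bounded) (odd-keep J) ⟩
        ΣA (map (λ I → -1# · prepend F.zero (shift (S.oddTerm J I))) subs) +A ΣA (map (λ I → shift (S.evenTerm J I)) subs)
          ≡⟨ P.cong₂ _+A_ (P.trans (ΣA-· -1# _ subs) (P.cong (-1# ·_) (P.trans (ΣA-prepend F.zero _ subs)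
                                    (P.cong (prepend F.zero) (ΣA-shift (S.oddTerm J) subs)))))
                          (ΣA-shift (S.evenTerm J) subs) ⟩
        (-1# · prepend F.zero (shift (S.tMinus q J))) +A shift (S.tPlus J)
          ≈⟨ +A-cong (·-congʳ -1# (prepend-cong F.zero (shift-cong ih⁻))) (shift-cong ih⁺) ⟩
        (-1# · prepend F.zero (shift (S.t⁻ (elems J)))) +A shift (S.t⁺ (elems J))
          ≡⟨ P.cong₂ (λ x y → (-1# · prepend F.zero x) +A y) (proj₂ (shift-t± (elems J))) (proj₁ (shift-t± (elems J))) ⟩
        (-1# · prepend F.zero (t⁻ w)) +A t⁺ w
          ≈⟨ +A-comm _ (t⁺ w) ⟩
        t⁻ (F.zero ∷ w) ∎
      even : tPlus (true ∷ J) ≋ t⁺ (F.zero ∷ w)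
      even = begin
        tPlus (true ∷ J)
          ≈⟨ sum-inside J (evenTerm (true ∷ J)) (λ I → prepend F.zero (shift (S.evenTerm J I))) (λ I → (-R q) · shift (S.oddTerm J I))
                        (All.map (λ {I} → even-skip J I) bounded) (even-keep J) ⟩
        ΣA (map (λ I → prepend F.zero (shift (S.evenTerm J I))) subs) +A ΣA (map (λ I → (-R q) · shift (S.oddTerm J I)) subs)
          ≡⟨ P.cong₂ _+A_ (P.trans (ΣA-prepend F.zero _ subs) (P.cong (prepend F.zero) (ΣA-shift (S.evenTerm J) subs)))
                          (P.trans (ΣA-· (-R q) _ subs) (P.cong ((-R q) ·_) (ΣA-shift (S.oddTerm J) subs))) ⟩
        prepend F.zero (shift (S.tPlus J)) +A ((-R q) · shift (S.tMinus q J))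
          ≈⟨ +A-cong (prepend-cong F.zero (shift-cong ih⁺)) (·-congʳ (-R q) (shift-cong ih⁻)) ⟩
        prepend F.zero (shift (S.t⁺ (elems J))) +A ((-R q) · shift (S.t⁻ (elems J)))
          ≡⟨ P.cong₂ (λ x y → prepend F.zero x +A ((-R q) · y)) (proj₁ (shift-t± (elems J))) (proj₂ (shift-t± (elems J))) ⟩
        t⁺ (F.zero ∷ w) ∎

  bridge : ∀ n (J : Subset n) → At.Bridged n J
  bridge zero [] = At.≋-refl 0 , At.monomial-cong 0 [] (trans (*-identityʳ _) (*-identityˡ _))
  bridge (suc n) (false ∷ J) = Step.step-outside n J (bridge n J)
  bridge (suc n) (true ∷ J) = Step.step-inside n J (bridge n J)

module Deletions {c ℓ} (R : CommutativeRing c ℓ) (n : ℕ) (q : CommutativeRing.Carrier R) where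
  open CommutativeRing R using (Carrier; trans; *-comm)
  open Bridge.At R q n
  open import Relation.Binary.Reasoning.Setoid ≋-setoid

  -- Σ_{i} Φ i (w with its i-th letter deleted), positions counted from 0.
  indexedDel : (ℕ → Word → A) → Word → A
  indexedDel Φ [] = 0A
  indexedDel Φ (a ∷ w) = Φ 0 w +A indexedDel (λ i r → Φ (suc i) (a ∷ r)) w

  indexedDel-cong : ∀ Φ Ψ w → (∀ i r → Φ i r ≋ Ψ i r) → indexedDel Φ w ≋ indexedDel Ψ w
  indexedDel-cong Φ Ψ [] Φ≋Ψ = ≋-refl
  indexedDel-cong Φ Ψ (a ∷ w) Φ≋Ψ = +A-cong (Φ≋Ψ 0 w) (indexedDel-cong _ _ w (λ i r → Φ≋Ψ (suc i) (a ∷ r)))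

  -- In a word without repeated letters, deleting the letter w_i is deleting position i.
  delete-by-position : ∀ (Φ : ℕ → Word → A) w → Distinct w →
    ΣA (map (λ p → Φ (proj₁ p) (without (proj₂ p) w)) (zip (positions (length w)) w)) ≋ indexedDel (λ i → Φ (suc i)) w
  delete-by-position Φ [] _ = ≋-refl
  delete-by-position Φ (a ∷ w) (a∉w ∷ distinct) = begin
    ΣA (map (λ p → Φ (proj₁ p) (without (proj₂ p) (a ∷ w))) (zip (positions (suc (length w))) (a ∷ w)))
      ≡⟨ P.cong (λ ps → ΣA (map (λ p → Φ (proj₁ p) (without (proj₂ p) (a ∷ w))) (zip ps (a ∷ w)))) (positions-suc (length w)) ⟩
    Φ 1 (without a (a ∷ w)) +A ΣA (map (λ p → Φ (proj₁ p) (without (proj₂ p) (a ∷ w))) (zip (map suc ps) w))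
      ≡⟨ P.cong₂ _+A_ (P.cong (Φ 1) (P.trans (without-head a w) (without-absent a (All.map (λ a≢x x≡a → a≢x (P.sym x≡a)) a∉w))))
                      (P.cong ΣA (P.trans (P.cong (map _) (zip-map-left suc ps w)) (P.sym (LP.map-∘ (zip ps w))))) ⟩
    Φ 1 w +A ΣA (map (λ p → Φ (suc (proj₁ p)) (without (proj₂ p) (a ∷ w))) (zip ps w))
      ≈⟨ +A-congˡ (Φ 1 w) (ΣA-cong _ _ (All.map (λ {p} a≢x → ≡⇒≋ (P.cong (Φ (suc (proj₁ p))) (without-other w a≢x))) (All-zip ps a∉w))) ⟩
    Φ 1 w +A ΣA (map (λ p → Φ (suc (proj₁ p)) (a ∷ without (proj₂ p) w)) (zip ps w))
      ≈⟨ +A-congˡ (Φ 1 w) (delete-by-position (λ i r → Φ (suc i) (a ∷ r)) w distinct) ⟩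
    indexedDel (λ i → Φ (suc i)) (a ∷ w) ∎
    where ps = positions (length w)

  indexed-deletion : ∀ (J : Subset n) (s : ℕ → Carrier) (H : Fin n → A) (Ψ : Word → A) →
    (∀ x → x ∈ J → H x ≋ Ψ (without x (elems J))) →
    ΣA (map (λ p → s (proj₁ p) · H (proj₂ p)) (zip (positions ∣ J ∣) (elems J))) ≋ indexedDel (λ i r → s (suc i) · Ψ r) (elems J)
  indexed-deletion J s H Ψ H≋Ψ = begin
    ΣA (map (λ p → s (proj₁ p) · H (proj₂ p)) (zip (positions ∣ J ∣) (elems J)))
      ≈⟨ ΣA-cong _ _ (All.map (λ {p} x∈J → ·-congʳ (s (proj₁ p)) (H≋Ψ (proj₂ p) x∈J)) (All-zip (positions ∣ J ∣) (elems-∈ J))) ⟩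
    ΣA (map (λ p → s (proj₁ p) · Ψ (without (proj₂ p) (elems J))) (zip (positions ∣ J ∣) (elems J)))
      ≡⟨ P.cong (λ m → ΣA (map (λ p → s (proj₁ p) · Ψ (without (proj₂ p) (elems J))) (zip (positions m) (elems J)))) (P.sym (length-elems J)) ⟩
    ΣA (map (λ p → s (proj₁ p) · Ψ (without (proj₂ p) (elems J))) (zip (positions (length (elems J))) (elems J)))
      ≈⟨ delete-by-position (λ i r → s i · Ψ r) (elems J) (elems-distinct J) ⟩
    indexedDel (λ i r → s (suc i) · Ψ r) (elems J) ∎

  indexedDel-left : ∀ (Ψ : Word → A) k w → indexedDel (λ i r → sgn (k + i) · Ψ r) w ≋ (sgn k · altDel Ψ w)
  indexedDel-left Ψ k [] = ≋-refl
  indexedDel-left Ψ k (a ∷ w) = begin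
    (sgn (k + 0) · Ψ w) +A indexedDel (λ i r → sgn (k + suc i) · Ψ (a ∷ r)) w
      ≈⟨ +A-cong (≡⇒≋ (P.cong (λ m → sgn m · Ψ w) (NP.+-identityʳ k)))
                 (indexedDel-cong _ _ w (λ i r → ≡⇒≋ (P.cong (λ m → sgn m · Ψ (a ∷ r)) (NP.+-suc k i)))) ⟩
    (sgn k · Ψ w) +A indexedDel (λ i r → sgn (suc k + i) · Ψ (a ∷ r)) w
      ≈⟨ +A-congˡ (sgn k · Ψ w) (indexedDel-left (λ r → Ψ (a ∷ r)) (suc k) w) ⟩
    (sgn k · Ψ w) +A (sgn (suc k) · altDel (λ r → Ψ (a ∷ r)) w)
      ≈⟨ +A-congˡ (sgn k · Ψ w) (≋-sym (·-· (sgn k) -1# _ (trans (*-comm (sgn k) -1#) (-1*sgn k)))) ⟩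
    (sgn k · Ψ w) +A (sgn k · (-1# · altDel (λ r → Ψ (a ∷ r)) w))
      ≡⟨ P.sym (·-+A (sgn k) (Ψ w) _) ⟩
    sgn k · altDel Ψ (a ∷ w) ∎

  indexedDel-right : ∀ (Ψ : Word → A) N k w → N ≡ k + length w →
                     indexedDel (λ i r → sgn (N ∸ suc (k + i)) · Ψ r) w ≋ altDelʳ Ψ w
  indexedDel-right Ψ N k [] _ = ≋-refl
  indexedDel-right Ψ N k (a ∷ w) N≡ = begin
    (sgn (N ∸ suc (k + 0)) · Ψ w) +A indexedDel (λ i r → sgn (N ∸ suc (k + suc i)) · Ψ (a ∷ r)) w
      ≈⟨ +A-cong (≡⇒≋ (P.cong (λ m → sgn m · Ψ w) first-sign))
                 (indexedDel-cong _ _ w (λ i r → ≡⇒≋ (P.cong (λ m → sgn (N ∸ suc m) · Ψ (a ∷ r)) (NP.+-suc k i)))) ⟩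
    (sgn (length w) · Ψ w) +A indexedDel (λ i r → sgn (N ∸ suc (suc k + i)) · Ψ (a ∷ r)) w
      ≈⟨ +A-congˡ (sgn (length w) · Ψ w) (indexedDel-right (λ r → Ψ (a ∷ r)) N (suc k) w (P.trans N≡ (NP.+-suc k (length w)))) ⟩
    altDelʳ Ψ (a ∷ w) ∎
    where
    first-sign : N ∸ suc (k + 0) ≡ length w
    first-sign = P.trans (P.cong₂ _∸_ (P.trans N≡ (NP.+-suc k (length w))) (P.cong suc (NP.+-identityʳ k)))
                         (NP.m+n∸m≡n (suc k) (length w))

  module Separated-Pair (K L : Subset n) (sep : Separated K L) where
    open Bridge R q using (bridge)
    u = elems K
    v = elems L

    remove : ∀ x → elems ((K ∪ L) - x) ≡ without x u ++ without x v
    remove x = P.trans (elems-remove (K ∪ L) x) (P.trans (P.cong (without x) (elems-∪ K L sep)) (without-++ x u v))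

    distinct-blocks : ∀ {k l} → k ∈ K → l ∈ L → k ≢ l
    distinct-blocks k∈K l∈L = FP.<⇒≢ (sep _ _ k∈K l∈L)

    remove-from-L : ∀ l → l ∈ L → elems ((K ∪ L) - l) ≡ u ++ without l v
    remove-from-L l l∈L = P.trans (remove l)
      (P.cong (_++ without l v) (without-absent l (All.map (λ k∈K → distinct-blocks k∈K l∈L) (elems-∈ K))))

    remove-from-K : ∀ k → k ∈ K → elems ((L ∪ K) - k) ≡ without k u ++ v
    remove-from-K k k∈K = P.trans (P.cong (λ M → elems (M - k)) (SP.∪-comm L K)) (P.trans (remove k)
      (P.cong (without k u ++_) (without-absent k (All.map (λ l∈L → P.≢-sym (distinct-blocks k∈K l∈L)) (elems-∈ L)))))

    product : (tMinus q K *A tMinus q L) ≋ (t⁻ u *A t⁻ v)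
    product = *A-cong (proj₁ (bridge n K)) (proj₁ (bridge n L))

    sum-over-L : rhsL q K L ≋ (t⁻ u *A t⁻ v)
    sum-over-L = begin
      rhsL q K L
        ≈⟨ indexed-deletion L (λ i → sgn (i ∸ 1)) (λ l → tMinus q ((K ∪ L) - l)) (λ r → t⁻ (u ++ r))
             (λ l l∈L → ≋-trans (proj₁ (bridge n ((K ∪ L) - l))) (≡⇒≋ (P.cong t⁻ (remove-from-L l l∈L)))) ⟩
      indexedDel (λ i r → sgn (0 + i) · t⁻ (u ++ r)) v
        ≈⟨ indexedDel-left (λ r → t⁻ (u ++ r)) 0 v ⟩
      sgn 0 · altDel (λ r → t⁻ (u ++ r)) v
        ≈⟨ ·-identity _ ⟩
      altDel (λ r → t⁻ (u ++ r)) v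
        ≈⟨ delete-right u v ⟩
      t⁻ u *A t⁻ v ∎

    sum-over-K : rhsK q K L ≋ (t⁻ u *A t⁻ v)
    sum-over-K = begin
      rhsK q K L
        ≈⟨ indexed-deletion K (λ i → sgn (∣ K ∣ ∸ i)) (λ k → tMinus q ((L ∪ K) - k)) (λ r → t⁻ (r ++ v))
             (λ k k∈K → ≋-trans (proj₁ (bridge n ((L ∪ K) - k))) (≡⇒≋ (P.cong t⁻ (remove-from-K k k∈K)))) ⟩
      indexedDel (λ i r → sgn (∣ K ∣ ∸ suc (0 + i)) · t⁻ (r ++ v)) u
        ≈⟨ indexedDel-right (λ r → t⁻ (r ++ v)) ∣ K ∣ 0 u (P.sym (length-elems K)) ⟩
      altDelʳ (λ r → t⁻ (r ++ v)) u
        ≈⟨ delete-left u v ⟩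
      t⁻ u *A t⁻ v ∎

lemma3p2 : ∀ {c ℓ} (R : CommutativeRing c ℓ) (n : ℕ) (q : CommutativeRing.Carrier R)
             (K L : Subset n) → (∀ k l → k ∈ K → l ∈ L → k < l) →
             let open FreeAlg R n in
             ((tMinus q K *A tMinus q L) ≈A rhsK q K L) × ((tMinus q K *A tMinus q L) ≈A rhsL q K L)
lemma3p2 R n q K L sep =
  get (≋-trans product (≋-sym sum-over-K)) , get (≋-trans product (≋-sym sum-over-L))
  where
  open Bridge.At R q n using (get; ≋-trans; ≋-sym)
  open Deletions R n q
  open Separated-Pair K L sep
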